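{- Let $n\ge 8$ be even and $G\in\mathcal{F}_n$. Then each of $1$ and $-1$ is a root of $\mu(G,x)$ with multiplicity exactly $\frac{n-4}{2}$.
   Context: $\mu(G,x)=\sum_k(-1)^kp_G(k)x^{n-2k}$ is the matching polynomial of a simple graph $G$ on $n$ vertices ($p_G(k)$ = number of $k$-edge matchings). For even $n$, $\mathcal{F}_n$ is the set of graphs obtained from $\frac{n}{2}K_2$ by choosing a vertex $w$ in one copy of $K_2$ and adding, for each copy of $K_2$ not containing $w$, at least one edge between $w$ and the vertices of that $K_2$ (and no other edges). -}

module Defs where

open import Data.Bool using (Bool; true; false; _∧_; _∨_; not; if_then_else_; T)
open import Data.Nat as ℕ using (ℕ; zero; suc; _∸_; _/_; _%_; _≡ᵇ_; _<ᵇ_)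
open import Data.Integer as ℤ using (ℤ; +_)
open import Data.Fin using (Fin; toℕ)
open import Data.List using (List; []; _∷_; _++_; map; concatMap; filterᵇ; allFin; length; upTo)
open import Data.Product using (_×_; _,_; Σ; ∃)
open import Relation.Binary.PropositionalEquality using (_≡_)
open import Relation.Nullary using (¬_)

record SimpleGraph (n : ℕ) : Set where
  field
    adj     : Fin n → Fin n → Bool
    adj-sym : ∀ u v → adj u v ≡ adj v u
    adj-irr : ∀ v → adj v v ≡ false

open SimpleGraph public

edges : ∀ {n} → SimpleGraph n → List (Fin n × Fin n)
edges {n} G =
  concatMap (λ i → map (λ j → (i , j))
                       (filterᵇ (λ j → (toℕ i <ᵇ toℕ j) ∧ adj G i j) (allFin n)))
            (allFin n)

sublists : ∀ {A : Set} → List A → List (List A)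
sublists []       = [] ∷ []
sublists (x ∷ xs) = sublists xs ++ map (x ∷_) (sublists xs)

_==F_ : ∀ {n} → Fin n → Fin n → Bool
i ==F j = toℕ i ≡ᵇ toℕ j

elemF : ∀ {n} → Fin n → List (Fin n) → Bool
elemF i []       = false
elemF i (j ∷ js) = (i ==F j) ∨ elemF i js

distinct : ∀ {n} → List (Fin n) → Bool
distinct []       = true
distinct (i ∷ is) = not (elemF i is) ∧ distinct is

endpoints : ∀ {n} → List (Fin n × Fin n) → List (Fin n)
endpoints = concatMap (λ { (i , j) → i ∷ j ∷ [] })

isMatching : ∀ {n} → List (Fin n × Fin n) → Bool
isMatching es = distinct (endpoints es)

matchingCount : ∀ {n} → SimpleGraph n → ℕ → ℕ
matchingCount G k =
  length (filterᵇ (λ es → isMatching es ∧ (length es ≡ᵇ k)) (sublists (edges G)))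

-- Polynomials over ℤ as coefficient lists (lowest degree first).

Poly : Set
Poly = List ℤ

coeff : Poly → ℕ → ℤ
coeff []       _       = + 0
coeff (a ∷ p)  zero    = a
coeff (a ∷ p)  (suc i) = coeff p i

_+ₚ_ : Poly → Poly → Poly
[]      +ₚ q       = q
(a ∷ p) +ₚ []      = a ∷ p
(a ∷ p) +ₚ (b ∷ q) = (a ℤ.+ b) ∷ (p +ₚ q)

_*ₚ_ : Poly → Poly → Poly
[]      *ₚ q = []
(a ∷ p) *ₚ q = map (a ℤ.*_) q +ₚ (+ 0 ∷ (p *ₚ q))

_^ₚ_ : Poly → ℕ → Poly
p ^ₚ zero  = + 1 ∷ []
p ^ₚ suc m = p *ₚ (p ^ₚ m)

X-_ : ℤ → Poly
X- a = ℤ.- a ∷ + 1 ∷ []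

_∣ₚ_ : Poly → Poly → Set
d ∣ₚ p = Σ Poly (λ q → ∀ i → coeff p i ≡ coeff (d *ₚ q) i)

RootMult : Poly → ℤ → ℕ → Set
RootMult p a m = (((X- a) ^ₚ m) ∣ₚ p) × ¬ (((X- a) ^ₚ suc m) ∣ₚ p)

-- The matching polynomial μ(G,x) = Σ_k (-1)^k p_G(k) x^(n-2k).

μ : ∀ {n} → SimpleGraph n → Poly
μ {n} G = map c (upTo (suc n))
  where
  c : ℕ → ℤ
  c d = if ((n ∸ d) % 2) ≡ᵇ 0
          then (ℤ.- + 1) ℤ.^ ((n ∸ d) / 2) ℤ.* + matchingCount G ((n ∸ d) / 2)
          else + 0

-- Vertices of (n/2)K₂ are Fin n; the copies of K₂ are
-- {2j, 2j+1}, i.e. vertex v lies in copy ⌊v/2⌋.  A member of 𝓕_n is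
-- given by the chosen vertex w and the set S (a Boolean predicate) of
-- vertices joined to w.

copy : ∀ {n} → Fin n → ℕ
copy v = toℕ v / 2

Admissible : (n : ℕ) → Fin n → (Fin n → Bool) → Set
Admissible n w S =
  (∀ v → S v ≡ true → ¬ (copy v ≡ copy w)) ×
  (∀ (j : ℕ) → j ℕ.< n / 2 → ¬ (j ≡ copy w) →
     Σ (Fin n) (λ v → (copy v ≡ j) × (S v ≡ true)))

FAdj : ∀ {n} → Fin n → (Fin n → Bool) → Fin n → Fin n → Bool
FAdj w S u v =
  ((copy u ≡ᵇ copy v) ∧ not (u ==F v))
  ∨ ((u ==F w) ∧ S v) ∨ ((v ==F w) ∧ S u)

-- G ∈ 𝓕_n (with the labelling of the vertices fixed as above)
InF : (n : ℕ) → SimpleGraph n → Set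
InF n G = Σ (Fin n) (λ w → Σ (Fin n → Bool) (λ S →
            Admissible n w S × (∀ u v → adj G u v ≡ FAdj w S u v)))

-- Split the k-edge matchings of G by the edge they use at the hub w: either none (a matching of
-- G − w, i.e. of m − 1 copies of K₂), the edge of w's own copy (then m − 1 copies remain), or one
-- of the d ≥ 1 edges to another copy (then m − 2 copies remain).  With n = 2m this gives
--   p(k + 1) = C(m, k + 1) + d C(m − 2, k).
-- As (x² − 1)^j = Σ_k (−1)^k C(j, k) x^(2j − 2k), comparing coefficients yields
--   μ(G, x) = (x² − 1)^m − d x² (x² − 1)^(m − 2) = (x − 1)^(m − 2) (x + 1)^(m − 2) ((x² − 1)² − d x²),
-- and the last factor equals −d ≠ 0 at x = ±1.

module Submission where

module Lists where

  open import Data.Bool using (Bool; true; false; _∧_; _∨_; not; if_then_else_; T; T?)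
  open import Data.Bool.ListAction using (all)
  open import Data.Bool.Properties using (∧-comm; ∧-zeroʳ; ∧-identityʳ)
  open import Data.Empty using (⊥-elim)
  open import Data.List using (List; []; _∷_; _++_; map; concatMap; filterᵇ; length; upTo)
  open import Data.List.Properties using (upTo-∷ʳ; concatMap-++; filter-++)
  open import Data.Nat using (ℕ; zero; suc; _+_; _*_; _<_; _≡ᵇ_; _<ᵇ_)
  open import Data.Nat.ListAction using (sum)
  open import Data.Nat.Properties using (≡ᵇ⇒≡; <ᵇ⇒<; <⇒<ᵇ; +-assoc; n<1+n; m<1+n⇒m<n∨m≡n; m<n⇒m<1+n; <⇒≢; >⇒≢)
  open import Data.Nat.Tactic.RingSolver using (solve-∀)
  open import Data.Product using (_×_; _,_; proj₂)
  open import Data.Sum using (_⊎_; inj₁; inj₂)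
  open import Function using (_∘_)
  open import Relation.Binary.PropositionalEquality

  private
    variable
      A B : Set

  ≡ᵇ-refl : ∀ n → (n ≡ᵇ n) ≡ true
  ≡ᵇ-refl zero    = refl
  ≡ᵇ-refl (suc n) = ≡ᵇ-refl n

  ≡ᵇ-sym : ∀ m n → (m ≡ᵇ n) ≡ (n ≡ᵇ m)
  ≡ᵇ-sym zero    zero    = refl
  ≡ᵇ-sym zero    (suc n) = refl
  ≡ᵇ-sym (suc m) zero    = refl
  ≡ᵇ-sym (suc m) (suc n) = ≡ᵇ-sym m n

  ≡ᵇ-true⇒≡ : ∀ {m n} → (m ≡ᵇ n) ≡ true → m ≡ n
  ≡ᵇ-true⇒≡ {m} {n} e = ≡ᵇ⇒≡ m n (subst T (sym e) _)

  ≡⇒≡ᵇ-true : ∀ {m n} → m ≡ n → (m ≡ᵇ n) ≡ true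
  ≡⇒≡ᵇ-true {m} refl = ≡ᵇ-refl m

  ≢⇒≡ᵇ-false : ∀ {m n} → m ≢ n → (m ≡ᵇ n) ≡ false
  ≢⇒≡ᵇ-false {m} {n} m≢n with m ≡ᵇ n in eq
  ... | true  = ⊥-elim (m≢n (≡ᵇ-true⇒≡ eq))
  ... | false = refl

  ≡ᵇ-false⇒≢ : ∀ {m n} → (m ≡ᵇ n) ≡ false → m ≢ n
  ≡ᵇ-false⇒≢ {m} e refl with () ← trans (sym (≡ᵇ-refl m)) e

  <ᵇ-true⇒< : ∀ {m n} → (m <ᵇ n) ≡ true → m < n
  <ᵇ-true⇒< {m} {n} e = <ᵇ⇒< m n (subst T (sym e) _)

  <⇒<ᵇ-true : ∀ {m n} → m < n → (m <ᵇ n) ≡ true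
  <⇒<ᵇ-true {m} {n} m<n with m <ᵇ n | <⇒<ᵇ m<n
  ... | true | _ = refl

  ≡true⇒T : ∀ {a} → a ≡ true → T a
  ≡true⇒T refl = _

  false≢true : false ≢ true
  false≢true ()

  ∧-true⁻ : ∀ {a b} → a ∧ b ≡ true → a ≡ true × b ≡ true
  ∧-true⁻ {true} {true} _ = refl , refl

  ∧-true⁺ : ∀ {a b} → a ≡ true → b ≡ true → a ∧ b ≡ true
  ∧-true⁺ refl refl = refl

  ∨-true⁻ : ∀ {a b} → a ∨ b ≡ true → a ≡ true ⊎ b ≡ true
  ∨-true⁻ {true}  _ = inj₁ refl
  ∨-true⁻ {false} e = inj₂ e

  ∨-trueˡ : ∀ {a} b → a ≡ true → a ∨ b ≡ true
  ∨-trueˡ b refl = refl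

  ∨-trueʳ : ∀ a {b} → b ≡ true → a ∨ b ≡ true
  ∨-trueʳ true  _ = refl
  ∨-trueʳ false e = e

  not-true⁻ : ∀ {a} → not a ≡ true → a ≡ false
  not-true⁻ {false} _ = refl

  not-true⁺ : ∀ {a} → a ≡ false → not a ≡ true
  not-true⁺ refl = refl

  true-ext : ∀ {a b} → (a ≡ true → b ≡ true) → (b ≡ true → a ≡ true) → a ≡ b
  true-ext {true}  {true}  _ _ = refl
  true-ext {true}  {false} f _ = sym (f refl)
  true-ext {false} {true}  _ g = g refl
  true-ext {false} {false} _ _ = refl

  filterᵇ-accept : ∀ (p : A → Bool) {x} xs → p x ≡ true → filterᵇ p (x ∷ xs) ≡ x ∷ filterᵇ p xs
  filterᵇ-accept p {x} xs e with p x
  ... | true = refl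

  filterᵇ-reject : ∀ (p : A → Bool) {x} xs → p x ≡ false → filterᵇ p (x ∷ xs) ≡ filterᵇ p xs
  filterᵇ-reject p {x} xs e with p x
  ... | false = refl

  filterᵇ-cong : ∀ {p q : A → Bool} → (∀ x → p x ≡ q x) → ∀ xs → filterᵇ p xs ≡ filterᵇ q xs
  filterᵇ-cong             eq []       = refl
  filterᵇ-cong {p = p} {q} eq (x ∷ xs) with p x | q x | eq x
  ... | true  | true  | refl = cong (x ∷_) (filterᵇ-cong eq xs)
  ... | false | false | refl = filterᵇ-cong eq xs

  filterᵇ-filterᵇ : ∀ (p q : A → Bool) xs → filterᵇ p (filterᵇ q xs) ≡ filterᵇ (λ x → q x ∧ p x) xs
  filterᵇ-filterᵇ p q [] = refl
  filterᵇ-filterᵇ p q (x ∷ xs) with q x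
  ... | false = filterᵇ-filterᵇ p q xs
  ... | true with p x
  ...   | true  = cong (x ∷_) (filterᵇ-filterᵇ p q xs)
  ...   | false = filterᵇ-filterᵇ p q xs

  filterᵇ-comm : ∀ (p q : A → Bool) xs → filterᵇ p (filterᵇ q xs) ≡ filterᵇ q (filterᵇ p xs)
  filterᵇ-comm p q xs = begin
    filterᵇ p (filterᵇ q xs)         ≡⟨ filterᵇ-filterᵇ p q xs ⟩
    filterᵇ (λ x → q x ∧ p x) xs     ≡⟨ filterᵇ-cong (λ x → ∧-comm (q x) (p x)) xs ⟩
    filterᵇ (λ x → p x ∧ q x) xs     ≡⟨ filterᵇ-filterᵇ q p xs ⟨
    filterᵇ q (filterᵇ p xs)         ∎
    where open ≡-Reasoning

  filterᵇ-map : ∀ (p : B → Bool) (f : A → B) xs → filterᵇ p (map f xs) ≡ map f (filterᵇ (λ x → p (f x)) xs)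
  filterᵇ-map p f [] = refl
  filterᵇ-map p f (x ∷ xs) with p (f x)
  ... | true  = cong (f x ∷_) (filterᵇ-map p f xs)
  ... | false = filterᵇ-map p f xs

  filterᵇ-none : ∀ (p : A → Bool) xs → (∀ x → p x ≡ false) → filterᵇ p xs ≡ []
  filterᵇ-none p []       _ = refl
  filterᵇ-none p (x ∷ xs) h rewrite filterᵇ-reject p xs (h x) = filterᵇ-none p xs h

  filterᵇ-all : ∀ (p : A → Bool) xs → all p xs ≡ true → filterᵇ p xs ≡ xs
  filterᵇ-all p [] _ = refl
  filterᵇ-all p (x ∷ xs) h with p x
  ... | true = cong (x ∷_) (filterᵇ-all p xs h)

  all-filterᵇ : ∀ (p q : A → Bool) xs → all p xs ≡ true → all p (filterᵇ q xs) ≡ true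
  all-filterᵇ p q [] _ = refl
  all-filterᵇ p q (x ∷ xs) h with q x
  ... | false = all-filterᵇ p q xs (proj₂ (∧-true⁻ h))
  ... | true with p x
  ...   | true = all-filterᵇ p q xs h

  all-filterᵇ-self : ∀ (p : A → Bool) xs → all p (filterᵇ p xs) ≡ true
  all-filterᵇ-self p [] = refl
  all-filterᵇ-self p (x ∷ xs) with p x in e
  ... | true rewrite e = all-filterᵇ-self p xs
  ... | false = all-filterᵇ-self p xs

  sum-map-+ : ∀ (g h : A → ℕ) xs → sum (map (λ x → g x + h x) xs) ≡ sum (map g xs) + sum (map h xs)
  sum-map-+ g h [] = refl
  sum-map-+ g h (x ∷ xs) rewrite sum-map-+ g h xs = interchange (g x) (h x) (sum (map g xs)) (sum (map h xs))
    where
    interchange : ∀ a b c d → a + b + (c + d) ≡ a + c + (b + d)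
    interchange = solve-∀

  sum-map-filterᵇ : ∀ (p : A → Bool) (g : A → ℕ) xs →
    sum (map g (filterᵇ p xs)) ≡ sum (map (λ x → if p x then g x else 0) xs)
  sum-map-filterᵇ p g [] = refl
  sum-map-filterᵇ p g (x ∷ xs) with p x
  ... | true  = cong (g x +_) (sum-map-filterᵇ p g xs)
  ... | false = sum-map-filterᵇ p g xs

  sum-map-cong-filterᵇ : ∀ (p : A → Bool) (g h : A → ℕ) xs → (∀ x → p x ≡ true → g x ≡ h x) →
    sum (map g (filterᵇ p xs)) ≡ sum (map h (filterᵇ p xs))
  sum-map-cong-filterᵇ p g h [] _ = refl
  sum-map-cong-filterᵇ p g h (x ∷ xs) g≐h with p x in e
  ... | true  = cong₂ _+_ (g≐h x e) (sum-map-cong-filterᵇ p g h xs g≐h)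
  ... | false = sum-map-cong-filterᵇ p g h xs g≐h

  sum-map-const-filterᵇ : ∀ (p : A → Bool) (g : A → ℕ) c xs → (∀ x → p x ≡ true → g x ≡ c) →
    sum (map g (filterᵇ p xs)) ≡ length (filterᵇ p xs) * c
  sum-map-const-filterᵇ p g c [] _ = refl
  sum-map-const-filterᵇ p g c (x ∷ xs) g≡c with p x in e
  ... | true  = cong₂ _+_ (g≡c x e) (sum-map-const-filterᵇ p g c xs g≡c)
  ... | false = sum-map-const-filterᵇ p g c xs g≡c

  sum-map-split : ∀ (p : A → Bool) (g : A → ℕ) xs →
    sum (map g xs) ≡ sum (map g (filterᵇ p xs)) + sum (map g (filterᵇ (λ x → not (p x)) xs))
  sum-map-split p g [] = refl
  sum-map-split p g (x ∷ xs) with p x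
  ... | true  rewrite sum-map-split p g xs = sym (+-assoc (g x) _ _)
  ... | false rewrite sum-map-split p g xs =
    swap (g x) (sum (map g (filterᵇ p xs))) (sum (map g (filterᵇ (λ x → not (p x)) xs)))
    where
    swap : ∀ a b c → a + (b + c) ≡ b + (a + c)
    swap = solve-∀

  upTo-suc : ∀ m → upTo (suc m) ≡ upTo m ++ m ∷ []
  upTo-suc m = sym (upTo-∷ʳ m)

  concatMap-cong-upTo : ∀ {B : Set} m (F G : ℕ → List B) → (∀ i → i < m → F i ≡ G i) →
    concatMap F (upTo m) ≡ concatMap G (upTo m)
  concatMap-cong-upTo zero    F G _   = refl
  concatMap-cong-upTo (suc m) F G F≐G = begin
    concatMap F (upTo (suc m))                   ≡⟨ cong (concatMap F) (upTo-suc m) ⟩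
    concatMap F (upTo m ++ m ∷ [])               ≡⟨ concatMap-++ F (upTo m) (m ∷ []) ⟩
    concatMap F (upTo m) ++ concatMap F (m ∷ [])
      ≡⟨ cong₂ _++_ (concatMap-cong-upTo m F G (λ i i<m → F≐G i (m<n⇒m<1+n i<m))) (cong (_++ []) (F≐G m (n<1+n m))) ⟩
    concatMap G (upTo m) ++ concatMap G (m ∷ [])  ≡⟨ concatMap-++ G (upTo m) (m ∷ []) ⟨
    concatMap G (upTo m ++ m ∷ [])                ≡⟨ cong (concatMap G) (upTo-suc m) ⟨
    concatMap G (upTo (suc m))                    ∎
    where open ≡-Reasoning

  filterᵇ-upTo-suc : ∀ m (p : ℕ → Bool) → filterᵇ p (upTo (suc m)) ≡ filterᵇ p (upTo m) ++ filterᵇ p (m ∷ [])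
  filterᵇ-upTo-suc m p = trans (cong (filterᵇ p) (upTo-suc m)) (filter-++ (T? ∘ p) (upTo m) (m ∷ []))

  filterᵇ-cong-upTo : ∀ m (p q : ℕ → Bool) → (∀ i → i < m → p i ≡ q i) → filterᵇ p (upTo m) ≡ filterᵇ q (upTo m)
  filterᵇ-cong-upTo zero    p q _   = refl
  filterᵇ-cong-upTo (suc m) p q p≐q = begin
    filterᵇ p (upTo (suc m))                    ≡⟨ filterᵇ-upTo-suc m p ⟩
    filterᵇ p (upTo m) ++ filterᵇ p (m ∷ [])
      ≡⟨ cong₂ _++_ (filterᵇ-cong-upTo m p q (λ i i<m → p≐q i (m<n⇒m<1+n i<m))) singleton ⟩
    filterᵇ q (upTo m) ++ filterᵇ q (m ∷ [])    ≡⟨ filterᵇ-upTo-suc m q ⟨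
    filterᵇ q (upTo (suc m))                    ∎
    where
    open ≡-Reasoning
    singleton : filterᵇ p (m ∷ []) ≡ filterᵇ q (m ∷ [])
    singleton with p m | q m | p≐q m (n<1+n m)
    ... | true  | true  | refl = refl
    ... | false | false | refl = refl

  filterᵇ-concatMap : ∀ {A B : Set} (p : B → Bool) (F : A → List B) xs →
    filterᵇ p (concatMap F xs) ≡ concatMap (λ x → filterᵇ p (F x)) xs
  filterᵇ-concatMap p F []       = refl
  filterᵇ-concatMap p F (x ∷ xs) = trans (filter-++ (T? ∘ p) (F x) (concatMap F xs)) (cong (filterᵇ p (F x) ++_) (filterᵇ-concatMap p F xs))

  filterᵇ-≡ᵇ-upTo : ∀ m a → a < m → filterᵇ (_≡ᵇ a) (upTo m) ≡ a ∷ []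
  filterᵇ-≡ᵇ-upTo (suc m) a a<1+m = trans (filterᵇ-upTo-suc m (_≡ᵇ a)) (last (m<1+n⇒m<n∨m≡n a<1+m))
    where
    last : a < m ⊎ a ≡ m → filterᵇ (_≡ᵇ a) (upTo m) ++ filterᵇ (_≡ᵇ a) (m ∷ []) ≡ a ∷ []
    last (inj₁ a<m) rewrite filterᵇ-≡ᵇ-upTo m a a<m | ≢⇒≡ᵇ-false (>⇒≢ a<m) = refl
    last (inj₂ refl) rewrite ≡ᵇ-refl a =
      cong (_++ a ∷ []) (trans (filterᵇ-cong-upTo a (_≡ᵇ a) (λ _ → false) (λ i i<a → ≢⇒≡ᵇ-false (<⇒≢ i<a)))
                               (filterᵇ-none (λ _ → false) (upTo a) (λ _ → refl)))

  filterᵇ-≡ᵇ∧-upTo : ∀ m a b → a < m → filterᵇ (λ j → (j ≡ᵇ a) ∧ b) (upTo m) ≡ (if b then a ∷ [] else [])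
  filterᵇ-≡ᵇ∧-upTo m a true  a<m = trans (filterᵇ-cong (λ j → ∧-identityʳ (j ≡ᵇ a)) (upTo m)) (filterᵇ-≡ᵇ-upTo m a a<m)
  filterᵇ-≡ᵇ∧-upTo m a false _   = filterᵇ-none _ (upTo m) (λ j → ∧-zeroʳ (j ≡ᵇ a))

module Matchings where

  open import Data.Bool using (Bool; true; false; _∧_; _∨_; not; if_then_else_; T?)
  open import Data.Bool.ListAction using (all)
  open import Data.Bool.Properties using (∧-assoc; ∧-zeroʳ)
  open import Data.List using (List; []; _∷_; _++_; map; filterᵇ; length)
  open import Data.List.Properties using (length-++; length-map; filter-++; length-filter)
  open import Function using (_∘_)
  open import Data.Nat using (ℕ; zero; suc; _+_; _≤_; s≤s; _≡ᵇ_)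
  open import Data.Nat.Combinatorics using (_C_; nCk+nC[k+1]≡[n+1]C[k+1])
  open import Data.Nat.ListAction using (sum)
  open import Data.Nat.Properties using (+-identityʳ; +-comm; ≤-refl; ≤-trans)
  open import Data.Nat.Tactic.RingSolver using (solve-∀)
  open import Data.Product using (_×_; _,_; proj₁; proj₂)
  open import Data.Sum using (_⊎_; inj₁; inj₂)
  open import Relation.Binary.PropositionalEquality
  open import Defs using (sublists)
  open Lists

  Edge : Set
  Edge = ℕ × ℕ

  elemᵇ : ℕ → List ℕ → Bool
  elemᵇ i []       = false
  elemᵇ i (j ∷ js) = (i ≡ᵇ j) ∨ elemᵇ i js

  distinctᵇ : List ℕ → Bool
  distinctᵇ []       = true
  distinctᵇ (i ∷ is) = not (elemᵇ i is) ∧ distinctᵇ is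

  endpointsℕ : List Edge → List ℕ
  endpointsℕ []             = []
  endpointsℕ ((a , b) ∷ es) = a ∷ b ∷ endpointsℕ es

  isMatchingℕ : List Edge → Bool
  isMatchingℕ es = distinctᵇ (endpointsℕ es)

  matchingCountℕ : List Edge → ℕ → ℕ
  matchingCountℕ E k = length (filterᵇ (λ es → isMatchingℕ es ∧ (length es ≡ᵇ k)) (sublists E))

  matchingCount₋₁ : List Edge → ℕ → ℕ
  matchingCount₋₁ E zero    = 0
  matchingCount₋₁ E (suc k) = matchingCountℕ E k

  nonLoop : Edge → Bool
  nonLoop (a , b) = not (a ≡ᵇ b)

  avoids : ℕ → Edge → Bool
  avoids x (a , b) = not (x ≡ᵇ a) ∧ not (x ≡ᵇ b)

  disjoint : Edge → Edge → Bool
  disjoint (a , b) f = avoids a f ∧ avoids b f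

  -- For the loop (w , w) this is the edge list of G − w.
  deleteEnds : Edge → List Edge → List Edge
  deleteEnds e = filterᵇ (disjoint e)

  touches : ℕ → Edge → Bool
  touches w f = not (disjoint (w , w) f)

  not-elemᵇ-endpoints : ∀ x es → not (elemᵇ x (endpointsℕ es)) ≡ all (avoids x) es
  not-elemᵇ-endpoints x [] = refl
  not-elemᵇ-endpoints x ((a , b) ∷ es) rewrite sym (not-elemᵇ-endpoints x es) with x ≡ᵇ a | x ≡ᵇ b
  ... | true  | _     = refl
  ... | false | true  = refl
  ... | false | false = refl

  all-∧ : ∀ {A : Set} (p q : A → Bool) xs → all (λ x → p x ∧ q x) xs ≡ all p xs ∧ all q xs
  all-∧ p q [] = refl
  all-∧ p q (x ∷ xs) rewrite all-∧ p q xs with p x | q x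
  ... | true  | true  = refl
  ... | true  | false = sym (∧-zeroʳ (all p xs))
  ... | false | _     = refl

  isMatchingℕ-∷ : ∀ e es → nonLoop e ≡ true → isMatchingℕ (e ∷ es) ≡ all (disjoint e) es ∧ isMatchingℕ es
  isMatchingℕ-∷ (a , b) es _ with a ≡ᵇ b
  ... | false rewrite not-elemᵇ-endpoints a es | not-elemᵇ-endpoints b es | all-∧ (avoids a) (avoids b) es =
    sym (∧-assoc (all (avoids a) es) (all (avoids b) es) (isMatchingℕ es))

  length-filterᵇ-++ : ∀ {A : Set} (p : A → Bool) xs ys →
    length (filterᵇ p (xs ++ ys)) ≡ length (filterᵇ p xs) + length (filterᵇ p ys)
  length-filterᵇ-++ p xs ys rewrite filter-++ (T? ∘ p) xs ys = length-++ (filterᵇ p xs)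

  length-filterᵇ-map : ∀ {A B : Set} (p : B → Bool) (f : A → B) xs →
    length (filterᵇ p (map f xs)) ≡ length (filterᵇ (λ x → p (f x)) xs)
  length-filterᵇ-map p f xs rewrite filterᵇ-map p f xs = length-map f (filterᵇ (λ x → p (f x)) xs)

  length-filterᵇ-sublists-∷ : ∀ {A : Set} (P : List A → Bool) e E →
    length (filterᵇ P (sublists (e ∷ E)))
      ≡ length (filterᵇ P (sublists E)) + length (filterᵇ (λ L → P (e ∷ L)) (sublists E))
  length-filterᵇ-sublists-∷ P e E =
    trans (length-filterᵇ-++ P (sublists E) _) (cong (length (filterᵇ P (sublists E)) +_) (length-filterᵇ-map P (e ∷_) (sublists E)))

  length-filterᵇ-sublists-all : ∀ {A : Set} (Q : A → Bool) (P : List A → Bool) E →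
    length (filterᵇ (λ L → all Q L ∧ P L) (sublists E)) ≡ length (filterᵇ P (sublists (filterᵇ Q E)))
  length-filterᵇ-sublists-all Q P [] with P []
  ... | true  = refl
  ... | false = refl
  length-filterᵇ-sublists-all {A} Q P (e ∷ E) with Q e in Qe
  ... | true = begin
      length (filterᵇ φ (sublists (e ∷ E)))
        ≡⟨ length-filterᵇ-sublists-∷ φ e E ⟩
      length (filterᵇ φ (sublists E)) + length (filterᵇ (λ L → φ (e ∷ L)) (sublists E))
        ≡⟨ cong (λ L → length (filterᵇ φ (sublists E)) + length L)
                (filterᵇ-cong (λ L → cong (λ b → (b ∧ all Q L) ∧ P (e ∷ L)) Qe) (sublists E)) ⟩
      length (filterᵇ φ (sublists E)) + length (filterᵇ (λ L → all Q L ∧ P (e ∷ L)) (sublists E))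
        ≡⟨ cong₂ _+_ (length-filterᵇ-sublists-all Q P E) (length-filterᵇ-sublists-all Q (λ L → P (e ∷ L)) E) ⟩
      length (filterᵇ P (sublists (filterᵇ Q E))) + length (filterᵇ (λ L → P (e ∷ L)) (sublists (filterᵇ Q E)))
        ≡⟨ length-filterᵇ-sublists-∷ P e (filterᵇ Q E) ⟨
      length (filterᵇ P (sublists (e ∷ filterᵇ Q E))) ∎
    where
    open ≡-Reasoning
    φ : List A → Bool
    φ L = all Q L ∧ P L
  ... | false = begin
      length (filterᵇ φ (sublists (e ∷ E)))
        ≡⟨ length-filterᵇ-sublists-∷ φ e E ⟩
      length (filterᵇ φ (sublists E)) + length (filterᵇ (λ L → φ (e ∷ L)) (sublists E))
        ≡⟨ cong (λ L → length (filterᵇ φ (sublists E)) + length L)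
                (filterᵇ-none _ (sublists E) (λ L → cong (λ b → (b ∧ all Q L) ∧ P (e ∷ L)) Qe)) ⟩
      length (filterᵇ φ (sublists E)) + 0
        ≡⟨ +-identityʳ _ ⟩
      length (filterᵇ φ (sublists E))
        ≡⟨ length-filterᵇ-sublists-all Q P E ⟩
      length (filterᵇ P (sublists (filterᵇ Q E))) ∎
    where
    open ≡-Reasoning
    φ : List A → Bool
    φ L = all Q L ∧ P L

  matchingCount-∷ : ∀ e E k → nonLoop e ≡ true →
    matchingCountℕ (e ∷ E) k ≡ matchingCountℕ E k + matchingCount₋₁ (deleteEnds e E) k
  matchingCount-∷ e E k e-nonLoop = begin
      matchingCountℕ (e ∷ E) k
        ≡⟨ length-filterᵇ-sublists-∷ ψ e E ⟩
      matchingCountℕ E k + length (filterᵇ (λ L → ψ (e ∷ L)) (sublists E))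
        ≡⟨ cong (λ L → matchingCountℕ E k + length L) (filterᵇ-cong extend (sublists E)) ⟩
      matchingCountℕ E k + length (filterᵇ (λ L → all (disjoint e) L ∧ ψ₋₁ L) (sublists E))
        ≡⟨ cong (matchingCountℕ E k +_) (length-filterᵇ-sublists-all (disjoint e) ψ₋₁ E) ⟩
      matchingCountℕ E k + length (filterᵇ ψ₋₁ (sublists (deleteEnds e E)))
        ≡⟨ cong (matchingCountℕ E k +_) (shifted k) ⟩
      matchingCountℕ E k + matchingCount₋₁ (deleteEnds e E) k ∎
    where
    open ≡-Reasoning
    ψ ψ₋₁ : List Edge → Bool
    ψ L = isMatchingℕ L ∧ (length L ≡ᵇ k)
    ψ₋₁ L = isMatchingℕ L ∧ (suc (length L) ≡ᵇ k)
    extend : ∀ L → ψ (e ∷ L) ≡ (all (disjoint e) L ∧ ψ₋₁ L)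
    extend L = trans (cong (_∧ (suc (length L) ≡ᵇ k)) (isMatchingℕ-∷ e L e-nonLoop)) (∧-assoc (all (disjoint e) L) _ _)
    shifted : ∀ k → length (filterᵇ (λ L → isMatchingℕ L ∧ (suc (length L) ≡ᵇ k)) (sublists (deleteEnds e E)))
                    ≡ matchingCount₋₁ (deleteEnds e E) k
    shifted zero = cong length (filterᵇ-none _ (sublists (deleteEnds e E)) (λ L → ∧-zeroʳ (isMatchingℕ L)))
    shifted (suc k) = refl

  matchingCount-zero : ∀ E → all nonLoop E ≡ true → matchingCountℕ E 0 ≡ 1
  matchingCount-zero [] _ = refl
  matchingCount-zero (e ∷ E) h with nonLoop e in e-nonLoop
  ... | true = trans (matchingCount-∷ e E 0 e-nonLoop) (trans (+-identityʳ _) (matchingCount-zero E h))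

  pairwiseDisjoint : List Edge → Bool
  pairwiseDisjoint []      = true
  pairwiseDisjoint (e ∷ E) = (nonLoop e ∧ all (disjoint e) E) ∧ pairwiseDisjoint E

  matchingCount-pairwiseDisjoint : ∀ E k → pairwiseDisjoint E ≡ true → matchingCountℕ E k ≡ length E C k
  matchingCount-pairwiseDisjoint [] zero    _ = refl
  matchingCount-pairwiseDisjoint [] (suc k) _ = refl
  matchingCount-pairwiseDisjoint (e ∷ E) k h with nonLoop e in e-nonLoop | all (disjoint e) E in e-disjoint
  matchingCount-pairwiseDisjoint (e ∷ E) zero h | true | true =
    trans (matchingCount-∷ e E 0 e-nonLoop) (trans (+-identityʳ _) (matchingCount-pairwiseDisjoint E 0 h))
  matchingCount-pairwiseDisjoint (e ∷ E) (suc k) h | true | true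
    rewrite matchingCount-∷ e E (suc k) e-nonLoop | filterᵇ-all (disjoint e) E e-disjoint
          | matchingCount-pairwiseDisjoint E (suc k) h | matchingCount-pairwiseDisjoint E k h =
    trans (+-comm (length E C suc k) (length E C k)) (nCk+nC[k+1]≡[n+1]C[k+1] (length E) k)

  disjoint-self : ∀ e → disjoint e e ≡ false
  disjoint-self (a , b) rewrite ≡ᵇ-refl a = refl

  disjoint-sym : ∀ e f → disjoint e f ≡ disjoint f e
  disjoint-sym (a , b) (c , d) rewrite ≡ᵇ-sym a c | ≡ᵇ-sym a d | ≡ᵇ-sym b c | ≡ᵇ-sym b d
    with c ≡ᵇ a | d ≡ᵇ a | c ≡ᵇ b | d ≡ᵇ b
  ... | true  | _     | _     | _     = refl
  ... | false | true  | true  | _     = refl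
  ... | false | true  | false | _     = refl
  ... | false | false | true  | true  = refl
  ... | false | false | true  | false = refl
  ... | false | false | false | true  = refl
  ... | false | false | false | false = refl

  avoids-true⁻ : ∀ x i j → avoids x (i , j) ≡ true → x ≢ i × x ≢ j
  avoids-true⁻ x i j h with ∧-true⁻ {not (x ≡ᵇ i)} h
  ... | x≢i , x≢j = ≡ᵇ-false⇒≢ (not-true⁻ x≢i) , ≡ᵇ-false⇒≢ (not-true⁻ x≢j)

  avoids-true⁺ : ∀ x i j → x ≢ i → x ≢ j → avoids x (i , j) ≡ true
  avoids-true⁺ x i j x≢i x≢j = ∧-true⁺ (not-true⁺ (≢⇒≡ᵇ-false x≢i)) (not-true⁺ (≢⇒≡ᵇ-false x≢j))

  touches⇒avoids-false : ∀ w e → touches w e ≡ true → avoids w e ≡ false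
  touches⇒avoids-false w e h with avoids w e
  ... | false = refl

  touches⇒end : ∀ w a b → touches w (a , b) ≡ true → w ≡ a ⊎ w ≡ b
  touches⇒end w a b h with w ≡ᵇ a in wa | w ≡ᵇ b in wb | touches⇒avoids-false w (a , b) h
  ... | true  | _    | _ = inj₁ (≡ᵇ-true⇒≡ wa)
  ... | false | true | _ = inj₂ (≡ᵇ-true⇒≡ wb)

  end⇒touches : ∀ w a b → w ≡ a ⊎ w ≡ b → touches w (a , b) ≡ true
  end⇒touches w a b (inj₁ refl) rewrite ≡ᵇ-refl w = refl
  end⇒touches w a b (inj₂ refl) rewrite ≡ᵇ-refl w | ∧-zeroʳ (not (w ≡ᵇ a)) = refl

  touches-touches⇒¬disjoint : ∀ w f e → touches w f ≡ true → touches w e ≡ true → disjoint f e ≡ false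
  touches-touches⇒¬disjoint w (a , b) e wf we with touches⇒end w a b wf | touches⇒avoids-false w e we
  ... | inj₁ refl | w-e = cong (_∧ avoids b e) w-e
  ... | inj₂ refl | w-e = trans (cong (avoids a e ∧_) w-e) (∧-zeroʳ (avoids a e))

  ¬touches⇒disjoint : ∀ w e → touches w e ≡ false → disjoint (w , w) e ≡ true
  ¬touches⇒disjoint w e h with disjoint (w , w) e
  ... | true = refl

  touches⇒¬disjoint : ∀ w e → touches w e ≡ true → disjoint (w , w) e ≡ false
  touches⇒¬disjoint w e h rewrite touches⇒avoids-false w e h = refl

  matchingCount-deleteEnds-∷ : ∀ f e E k → nonLoop e ≡ true →
    matchingCountℕ (deleteEnds f (e ∷ E)) k
      ≡ matchingCountℕ (deleteEnds f E) k + (if disjoint f e then matchingCount₋₁ (deleteEnds e (deleteEnds f E)) k else 0)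
  matchingCount-deleteEnds-∷ f e E k e-nonLoop with disjoint f e
  ... | true  = matchingCount-∷ e (deleteEnds f E) k e-nonLoop
  ... | false = sym (+-identityʳ _)

  StarSplit : ℕ → List Edge → ℕ → Set
  StarSplit w E k = matchingCountℕ E k ≡ matchingCountℕ (deleteEnds (w , w) E) k
                                          + sum (map (λ f → matchingCount₋₁ (deleteEnds f E) k) (filterᵇ (touches w) E))

  starSplit-zero : ∀ w E → all nonLoop E ≡ true → StarSplit w E 0
  starSplit-zero w E E-nonLoop rewrite matchingCount-zero E E-nonLoop
    | matchingCount-zero (deleteEnds (w , w) E) (all-filterᵇ nonLoop (disjoint (w , w)) E E-nonLoop) =
    sym (cong (1 +_) (sum-map-zero (filterᵇ (touches w) E)))
    where
    sum-map-zero : ∀ (xs : List Edge) → sum (map (λ _ → 0) xs) ≡ 0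
    sum-map-zero []       = refl
    sum-map-zero (_ ∷ xs) = sum-map-zero xs

  starSplit-∷-touching : ∀ w e E k → nonLoop e ≡ true → touches w e ≡ true →
    StarSplit w E (suc k) → StarSplit w (e ∷ E) (suc k)
  starSplit-∷-touching w e E k e-nonLoop we IH rewrite filterᵇ-reject (disjoint (w , w)) E (touches⇒¬disjoint w e we) | we = begin
      matchingCountℕ (e ∷ E) (suc k)
        ≡⟨ matchingCount-∷ e E (suc k) e-nonLoop ⟩
      matchingCountℕ E (suc k) + matchingCountℕ (deleteEnds e E) k
        ≡⟨ cong (_+ matchingCountℕ (deleteEnds e E) k) IH ⟩
      A + Σ + matchingCountℕ (deleteEnds e E) k
        ≡⟨ regroup A Σ _ ⟩
      A + (matchingCountℕ (deleteEnds e E) k + Σ)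
        ≡⟨ cong (A +_) (cong₂ _+_ (cong (λ L → matchingCountℕ L k) (sym (filterᵇ-reject (disjoint e) E (disjoint-self e))))
                                  (sum-map-cong-filterᵇ (touches w) _ _ E
                                    (λ f wf → cong (λ L → matchingCountℕ L k)
                                                   (sym (filterᵇ-reject (disjoint f) E (touches-touches⇒¬disjoint w f e wf we)))))) ⟩
      A + (matchingCountℕ (deleteEnds e (e ∷ E)) k + sum (map (λ f → matchingCountℕ (deleteEnds f (e ∷ E)) k) (filterᵇ (touches w) E))) ∎
    where
    open ≡-Reasoning
    A Σ : ℕ
    A = matchingCountℕ (deleteEnds (w , w) E) (suc k)
    Σ = sum (map (λ f → matchingCountℕ (deleteEnds f E) k) (filterᵇ (touches w) E))
    regroup : ∀ a s x → a + s + x ≡ a + (x + s)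
    regroup = solve-∀

  -- The matchings containing e are those of G − V(e), which split at w in turn.
  starSplit-∷-avoiding : ∀ w e E k → nonLoop e ≡ true → touches w e ≡ false →
    StarSplit w E (suc k) → StarSplit w (deleteEnds e E) k → StarSplit w (e ∷ E) (suc k)
  starSplit-∷-avoiding w e E k e-nonLoop we IH IH′ rewrite filterᵇ-accept (disjoint (w , w)) E (¬touches⇒disjoint w e we) | we = begin
      matchingCountℕ (e ∷ E) (suc k)
        ≡⟨ matchingCount-∷ e E (suc k) e-nonLoop ⟩
      matchingCountℕ E (suc k) + matchingCountℕ E′ k
        ≡⟨ cong₂ _+_ IH (trans IH′ (cong (λ L → matchingCountℕ L k + Σ′) (filterᵇ-comm (disjoint (w , w)) (disjoint e) E))) ⟩
      A + Σ + (B + Σ′)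
        ≡⟨ cong (λ s → A + Σ + (B + s)) Σ′≡Σ″ ⟩
      A + Σ + (B + Σ″)
        ≡⟨ regroup A Σ B Σ″ ⟩
      A + B + (Σ + Σ″)
        ≡⟨ cong₂ _+_ (sym (matchingCount-∷ e (deleteEnds (w , w) E) (suc k) e-nonLoop))
                     (sym (sum-map-+ g g″ (filterᵇ (touches w) E))) ⟩
      matchingCountℕ (e ∷ deleteEnds (w , w) E) (suc k) + sum (map (λ f → g f + g″ f) (filterᵇ (touches w) E))
        ≡⟨ cong (matchingCountℕ (e ∷ deleteEnds (w , w) E) (suc k) +_)
                (sum-map-cong-filterᵇ (touches w) _ _ E (λ f _ → sym (matchingCount-deleteEnds-∷ f e E k e-nonLoop))) ⟩
      matchingCountℕ (e ∷ deleteEnds (w , w) E) (suc k)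
        + sum (map (λ f → matchingCountℕ (deleteEnds f (e ∷ E)) k) (filterᵇ (touches w) E)) ∎
    where
    open ≡-Reasoning
    E′ : List Edge
    E′ = deleteEnds e E
    A B : ℕ
    A = matchingCountℕ (deleteEnds (w , w) E) (suc k)
    B = matchingCountℕ (deleteEnds e (deleteEnds (w , w) E)) k
    g g″ : Edge → ℕ
    g f = matchingCountℕ (deleteEnds f E) k
    g″ f = if disjoint f e then matchingCount₋₁ (deleteEnds e (deleteEnds f E)) k else 0
    Σ Σ′ Σ″ : ℕ
    Σ = sum (map g (filterᵇ (touches w) E))
    Σ′ = sum (map (λ f → matchingCount₋₁ (deleteEnds f E′) k) (filterᵇ (touches w) E′))
    Σ″ = sum (map g″ (filterᵇ (touches w) E))
    regroup : ∀ a s b t → a + s + (b + t) ≡ a + b + (s + t)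
    regroup = solve-∀
    Σ′≡Σ″ : Σ′ ≡ Σ″
    Σ′≡Σ″ = begin
      Σ′
        ≡⟨ cong (λ L → sum (map (λ f → matchingCount₋₁ (deleteEnds f E′) k) L)) (filterᵇ-comm (touches w) (disjoint e) E) ⟩
      sum (map (λ f → matchingCount₋₁ (deleteEnds f E′) k) (filterᵇ (disjoint e) (filterᵇ (touches w) E)))
        ≡⟨ sum-map-filterᵇ (disjoint e) _ (filterᵇ (touches w) E) ⟩
      sum (map (λ f → if disjoint e f then matchingCount₋₁ (deleteEnds f E′) k else 0) (filterᵇ (touches w) E))
        ≡⟨ sum-map-cong-filterᵇ (touches w) _ _ E (λ f _ → pointwise f) ⟩
      Σ″ ∎
      where
      pointwise : ∀ f → (if disjoint e f then matchingCount₋₁ (deleteEnds f E′) k else 0) ≡ g″ f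
      pointwise f rewrite disjoint-sym e f | filterᵇ-comm (disjoint f) (disjoint e) E = refl

  -- Induction on a bound for length E, since the recursive call is also made on deleteEnds e E.
  matchingCount-star : ∀ w E → all nonLoop E ≡ true → ∀ k → StarSplit w E k
  matchingCount-star w E nonLoops = go (length E) E ≤-refl nonLoops
    where
    go : ∀ fuel E → length E ≤ fuel → all nonLoop E ≡ true → ∀ k → StarSplit w E k
    go fuel       E       _  E-nonLoop zero    = starSplit-zero w E E-nonLoop
    go fuel       []      _  _         (suc k) = refl
    go (suc fuel) (e ∷ E) (s≤s |E|≤fuel) eE-nonLoop (suc k) = split (touches w e) refl
      where
      e-nonLoop : nonLoop e ≡ true
      e-nonLoop = proj₁ (∧-true⁻ {nonLoop e} eE-nonLoop)
      E-nonLoop : all nonLoop E ≡ true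
      E-nonLoop = proj₂ (∧-true⁻ {nonLoop e} eE-nonLoop)
      split : ∀ b → touches w e ≡ b → StarSplit w (e ∷ E) (suc k)
      split true  we = starSplit-∷-touching w e E k e-nonLoop we (go fuel E |E|≤fuel E-nonLoop (suc k))
      split false we = starSplit-∷-avoiding w e E k e-nonLoop we (go fuel E |E|≤fuel E-nonLoop (suc k))
                         (go fuel (deleteEnds e E) (≤-trans (length-filter (T? ∘ disjoint e) E) |E|≤fuel)
                             (all-filterᵇ nonLoop (disjoint e) E E-nonLoop) k)

module Copies where

  open import Data.Bool using (Bool; true; false; _∧_; _∨_; not; if_then_else_)
  open import Data.Bool.ListAction using (all)
  open import Data.Bool.Properties using (∧-zeroʳ; ∧-identityʳ)
  open import Data.Empty using (⊥-elim)
  open import Data.List using (List; []; _∷_; _++_; map; concatMap; filterᵇ; length; upTo)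
  open import Data.List.Properties
    using (length-++; length-map; map-upTo; concatMap-++; map-++; ++-identityʳ; length-upTo)
  open import Data.Nat using (ℕ; zero; suc; _+_; _*_; _∸_; _/_; _≤_; _<_; z≤n; s≤s; _≡ᵇ_; ⌊_/2⌋)
  open import Data.Nat.Combinatorics using (_C_)
  open import Data.Nat.DivMod using (m/n≡1+[m∸n]/n)
  open import Data.Nat.Properties using (+-identityʳ; ≤-trans; n≤1+n; n<1+n; <-irrefl; m<1+n⇒m<n∨m≡n; <⇒≢; >⇒≢)
  open import Data.Product using (_×_; _,_)
  open import Data.Sum using (_⊎_; inj₁; inj₂)
  open import Data.Nat.Tactic.RingSolver using (solve-∀)
  open import Relation.Binary.PropositionalEquality
  open Lists
  open Matchings

  even : ℕ → Bool
  even zero          = true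
  even (suc zero)    = false
  even (suc (suc n)) = even n

  ⌊n/2⌋≡n/2 : ∀ n → ⌊ n /2⌋ ≡ n / 2
  ⌊n/2⌋≡n/2 zero          = refl
  ⌊n/2⌋≡n/2 (suc zero)    = refl
  ⌊n/2⌋≡n/2 (suc (suc n)) = trans (cong suc (⌊n/2⌋≡n/2 n)) (sym (m/n≡1+[m∸n]/n {suc (suc n)} {2} (s≤s (s≤s z≤n))))

  ⌊k*2/2⌋≡k : ∀ k → ⌊ k * 2 /2⌋ ≡ k
  ⌊k*2/2⌋≡k zero    = refl
  ⌊k*2/2⌋≡k (suc k) = cong suc (⌊k*2/2⌋≡k k)

  ⌊1+k*2/2⌋≡k : ∀ k → ⌊ suc (k * 2) /2⌋ ≡ k
  ⌊1+k*2/2⌋≡k zero    = refl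
  ⌊1+k*2/2⌋≡k (suc k) = cong suc (⌊1+k*2/2⌋≡k k)

  even-k*2 : ∀ k → even (k * 2) ≡ true
  even-k*2 zero    = refl
  even-k*2 (suc k) = even-k*2 k

  even-1+k*2 : ∀ k → even (suc (k * 2)) ≡ false
  even-1+k*2 zero    = refl
  even-1+k*2 (suc k) = even-1+k*2 k

  parity-view : ∀ i → (even i ≡ true × i ≡ ⌊ i /2⌋ * 2) ⊎ (even i ≡ false × i ≡ suc (⌊ i /2⌋ * 2))
  parity-view zero       = inj₁ (refl , refl)
  parity-view (suc zero) = inj₂ (refl , refl)
  parity-view (suc (suc i)) with parity-view i
  ... | inj₁ (e , i≡) = inj₁ (e , cong (λ j → suc (suc j)) i≡)
  ... | inj₂ (e , i≡) = inj₂ (e , cong (λ j → suc (suc j)) i≡)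

  even⇒≡⌊/2⌋*2 : ∀ {i} → even i ≡ true → i ≡ ⌊ i /2⌋ * 2
  even⇒≡⌊/2⌋*2 {i} e with parity-view i
  ... | inj₁ (_ , i≡) = i≡
  ... | inj₂ (e′ , _) = ⊥-elim (false≢true (trans (sym e′) e))

  ⌊1+i/2⌋≡⌊i/2⌋ : ∀ i → even i ≡ true → ⌊ suc i /2⌋ ≡ ⌊ i /2⌋
  ⌊1+i/2⌋≡⌊i/2⌋ i e = subst (λ j → ⌊ suc j /2⌋ ≡ ⌊ j /2⌋) (sym (even⇒≡⌊/2⌋*2 e))
                                (trans (⌊1+k*2/2⌋≡k ⌊ i /2⌋) (sym (⌊k*2/2⌋≡k ⌊ i /2⌋)))

  1+k*2<l*2 : ∀ k l → k * 2 < l * 2 → suc (k * 2) < l * 2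
  1+k*2<l*2 zero    (suc l) _                 = s≤s (s≤s z≤n)
  1+k*2<l*2 (suc k) (suc l) (s≤s (s≤s k<l)) = s≤s (s≤s (1+k*2<l*2 k l k<l))

  even⇒1+i<l*2 : ∀ {i} l → even i ≡ true → i < l * 2 → suc i < l * 2
  even⇒1+i<l*2 {i} l e i<l*2 = subst (λ j → suc j < l * 2) (sym (even⇒≡⌊/2⌋*2 e))
                                      (1+k*2<l*2 ⌊ i /2⌋ l (subst (_< l * 2) (even⇒≡⌊/2⌋*2 e) i<l*2))

  ⌊i/2⌋<l : ∀ {i} l → i < l * 2 → ⌊ i /2⌋ < l
  ⌊i/2⌋<l {zero}          (suc l) _                 = s≤s z≤n
  ⌊i/2⌋<l {suc zero}      (suc l) _                 = s≤s z≤n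
  ⌊i/2⌋<l {suc (suc i)}   (suc l) (s≤s (s≤s i<l*2)) = s≤s (⌊i/2⌋<l l i<l*2)

  same-copy-< : ∀ {i j} → i < j → ⌊ i /2⌋ ≡ ⌊ j /2⌋ → even i ≡ true × j ≡ suc i
  same-copy-< {i} {j} i<j same with parity-view i | parity-view j
  ... | inj₁ (_ , i≡)  | inj₁ (_ , j≡) = ⊥-elim (<-irrefl (trans i≡ (trans (cong (_* 2) same) (sym j≡))) i<j)
  ... | inj₁ (ei , i≡) | inj₂ (_ , j≡) = ei , trans j≡ (cong suc (trans (cong (_* 2) (sym same)) (sym i≡)))
  ... | inj₂ (_ , i≡)  | inj₁ (_ , j≡) =
    ⊥-elim (<-irrefl refl (≤-trans (subst₂ _<_ (sym j≡) (sym i≡) (subst (λ x → x * 2 < suc (⌊ i /2⌋ * 2)) same (n<1+n _)))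
                                   (≤-trans (n≤1+n _) i<j)))
  ... | inj₂ (_ , i≡)  | inj₂ (_ , j≡) = ⊥-elim (<-irrefl (trans i≡ (trans (cong (λ x → suc (x * 2)) same) (sym j≡))) i<j)

  same-copy : ∀ {i a} → even i ≡ true → ⌊ a /2⌋ ≡ ⌊ i /2⌋ → a ≡ i ⊎ a ≡ suc i
  same-copy {i} {a} ei same with parity-view a
  ... | inj₁ (_ , a≡) = inj₁ (trans a≡ (trans (cong (_* 2) same) (sym (even⇒≡⌊/2⌋*2 ei))))
  ... | inj₂ (_ , a≡) = inj₂ (trans a≡ (cong suc (trans (cong (_* 2) same) (sym (even⇒≡⌊/2⌋*2 ei)))))

  countBelow : (ℕ → Bool) → ℕ → ℕ
  countBelow c m = length (filterᵇ c (upTo m))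

  countBelow-suc : ∀ c m → countBelow c (suc m) ≡ countBelow c m + (if c m then 1 else 0)
  countBelow-suc c m rewrite filterᵇ-upTo-suc m c | length-++ (filterᵇ c (upTo m)) {filterᵇ c (m ∷ [])} with c m
  ... | true  = refl
  ... | false = refl

  countBelow-true : ∀ m → countBelow (λ _ → true) m ≡ m
  countBelow-true m = trans (cong length (filterᵇ-all (λ _ → true) (upTo m) (all-true (upTo m)))) (length-upTo m)
    where
    all-true : ∀ xs → all (λ (_ : ℕ) → true) xs ≡ true
    all-true []       = refl
    all-true (_ ∷ xs) = all-true xs

  countBelow-remove : ∀ c m q → q < m → c q ≡ true → countBelow (λ x → c x ∧ not (x ≡ᵇ q)) m + 1 ≡ countBelow c m
  countBelow-remove c (suc m) q q<1+m cq with m<1+n⇒m<n∨m≡n q<1+m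
  ... | inj₁ q<m = begin
      countBelow c′ (suc m) + 1                    ≡⟨ cong (_+ 1) (countBelow-suc c′ m) ⟩
      countBelow c′ m + bit (c′ m) + 1             ≡⟨ cong (λ b → countBelow c′ m + bit b + 1) m-kept ⟩
      countBelow c′ m + bit (c m) + 1              ≡⟨ swap (countBelow c′ m) (bit (c m)) ⟩
      countBelow c′ m + 1 + bit (c m)              ≡⟨ cong (_+ bit (c m)) (countBelow-remove c m q q<m cq) ⟩
      countBelow c m + bit (c m)                   ≡⟨ countBelow-suc c m ⟨
      countBelow c (suc m)                         ∎
    where
    open ≡-Reasoning
    c′ : ℕ → Bool
    c′ x = c x ∧ not (x ≡ᵇ q)
    bit : Bool → ℕ
    bit b = if b then 1 else 0
    m-kept : c′ m ≡ c m
    m-kept = trans (cong (λ b → c m ∧ not b) (≢⇒≡ᵇ-false (>⇒≢ q<m))) (∧-identityʳ (c m))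
    swap : ∀ a b → a + b + 1 ≡ a + 1 + b
    swap = solve-∀
  ... | inj₂ refl = begin
      countBelow c′ (suc q) + 1                    ≡⟨ cong (_+ 1) (countBelow-suc c′ q) ⟩
      countBelow c′ q + bit (c′ q) + 1             ≡⟨ cong₂ (λ n b → n + bit b + 1) below q-dropped ⟩
      countBelow c q + 0 + 1                       ≡⟨ cong (λ n → n + 1) (+-identityʳ _) ⟩
      countBelow c q + 1                           ≡⟨ cong (λ b → countBelow c q + bit b) cq ⟨
      countBelow c q + bit (c q)                   ≡⟨ countBelow-suc c q ⟨
      countBelow c (suc q)                         ∎
    where
    open ≡-Reasoning
    c′ : ℕ → Bool
    c′ x = c x ∧ not (x ≡ᵇ q)
    bit : Bool → ℕ
    bit b = if b then 1 else 0
    below : countBelow c′ q ≡ countBelow c q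
    below = cong length (filterᵇ-cong-upTo q c′ c
              (λ i i<q → trans (cong (λ b → c i ∧ not b) (≢⇒≡ᵇ-false (<⇒≢ i<q))) (∧-identityʳ (c i))))
    q-dropped : c′ q ≡ false
    q-dropped rewrite ≡ᵇ-refl q = ∧-zeroʳ (c q)

  copyEdge : ℕ → Edge
  copyEdge x = (x * 2 , suc (x * 2))

  copies : (ℕ → Bool) → ℕ → List Edge
  copies c m = map copyEdge (filterᵇ c (upTo m))

  concatMap-copies : ∀ m (c : ℕ → Bool) →
    concatMap (λ i → if even i ∧ c ⌊ i /2⌋ then (i , suc i) ∷ [] else []) (upTo (m * 2)) ≡ copies c m
  concatMap-copies zero    c = refl
  concatMap-copies (suc m) c = begin
      concatMap F (upTo (suc (suc (m * 2))))
        ≡⟨ cong (concatMap F) (trans (upTo-suc (suc (m * 2))) (cong (_++ suc (m * 2) ∷ []) (upTo-suc (m * 2)))) ⟩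
      concatMap F ((upTo (m * 2) ++ m * 2 ∷ []) ++ suc (m * 2) ∷ [])
        ≡⟨ concatMap-++ F (upTo (m * 2) ++ m * 2 ∷ []) (suc (m * 2) ∷ []) ⟩
      concatMap F (upTo (m * 2) ++ m * 2 ∷ []) ++ concatMap F (suc (m * 2) ∷ [])
        ≡⟨ cong₂ _++_ (concatMap-++ F (upTo (m * 2)) (m * 2 ∷ [])) odd-row ⟩
      (concatMap F (upTo (m * 2)) ++ concatMap F (m * 2 ∷ [])) ++ []
        ≡⟨ ++-identityʳ _ ⟩
      concatMap F (upTo (m * 2)) ++ concatMap F (m * 2 ∷ [])
        ≡⟨ cong₂ _++_ (concatMap-copies m c) even-row ⟩
      copies c m ++ map copyEdge (filterᵇ c (m ∷ []))
        ≡⟨ map-++ copyEdge (filterᵇ c (upTo m)) (filterᵇ c (m ∷ [])) ⟨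
      map copyEdge (filterᵇ c (upTo m) ++ filterᵇ c (m ∷ []))
        ≡⟨ cong (map copyEdge) (filterᵇ-upTo-suc m c) ⟨
      copies c (suc m) ∎
    where
    open ≡-Reasoning
    F = λ i → if even i ∧ c ⌊ i /2⌋ then (i , suc i) ∷ [] else []
    odd-row : concatMap F (suc (m * 2) ∷ []) ≡ []
    odd-row rewrite even-1+k*2 m = refl
    even-row : concatMap F (m * 2 ∷ []) ≡ map copyEdge (filterᵇ c (m ∷ []))
    even-row rewrite even-k*2 m | ⌊k*2/2⌋≡k m with c m
    ... | true  = refl
    ... | false = refl

  disjoint-copyEdge : ∀ a b → disjoint (copyEdge a) (copyEdge b) ≡ not (a ≡ᵇ b)
  disjoint-copyEdge zero    zero    = refl
  disjoint-copyEdge zero    (suc b) = refl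
  disjoint-copyEdge (suc a) zero    = refl
  disjoint-copyEdge (suc a) (suc b) = disjoint-copyEdge a b

  nonLoop-copyEdge : ∀ a → nonLoop (copyEdge a) ≡ true
  nonLoop-copyEdge zero    = refl
  nonLoop-copyEdge (suc a) = nonLoop-copyEdge a

  all-disjoint-copyEdge : ∀ a xs → all (disjoint (copyEdge a)) (map copyEdge xs) ≡ not (elemᵇ a xs)
  all-disjoint-copyEdge a []       = refl
  all-disjoint-copyEdge a (b ∷ xs) rewrite disjoint-copyEdge a b | all-disjoint-copyEdge a xs with a ≡ᵇ b
  ... | true  = refl
  ... | false = refl

  pairwiseDisjoint-copyEdges : ∀ xs → pairwiseDisjoint (map copyEdge xs) ≡ distinctᵇ xs
  pairwiseDisjoint-copyEdges []       = refl
  pairwiseDisjoint-copyEdges (a ∷ xs) rewrite nonLoop-copyEdge a | all-disjoint-copyEdge a xs | pairwiseDisjoint-copyEdges xs = refl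

  elemᵇ-filterᵇ : ∀ x (c : ℕ → Bool) xs → elemᵇ x xs ≡ false → elemᵇ x (filterᵇ c xs) ≡ false
  elemᵇ-filterᵇ x c []       _ = refl
  elemᵇ-filterᵇ x c (y ∷ xs) h with x ≡ᵇ y in x≡ᵇy | c y
  ... | false | true rewrite x≡ᵇy = elemᵇ-filterᵇ x c xs h
  ... | false | false = elemᵇ-filterᵇ x c xs h

  distinctᵇ-filterᵇ : ∀ (c : ℕ → Bool) xs → distinctᵇ xs ≡ true → distinctᵇ (filterᵇ c xs) ≡ true
  distinctᵇ-filterᵇ c []       _ = refl
  distinctᵇ-filterᵇ c (y ∷ xs) h with ∧-true⁻ {not (elemᵇ y xs)} h
  ... | y∉xs , xs-distinct with c y
  ...   | true  = ∧-true⁺ (not-true⁺ (elemᵇ-filterᵇ y c xs (not-true⁻ y∉xs))) (distinctᵇ-filterᵇ c xs xs-distinct)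
  ...   | false = distinctᵇ-filterᵇ c xs xs-distinct

  elemᵇ-map-suc : ∀ x xs → elemᵇ (suc x) (map suc xs) ≡ elemᵇ x xs
  elemᵇ-map-suc x []       = refl
  elemᵇ-map-suc x (y ∷ xs) = cong ((x ≡ᵇ y) ∨_) (elemᵇ-map-suc x xs)

  elemᵇ-zero-map-suc : ∀ xs → elemᵇ 0 (map suc xs) ≡ false
  elemᵇ-zero-map-suc []       = refl
  elemᵇ-zero-map-suc (_ ∷ xs) = elemᵇ-zero-map-suc xs

  distinctᵇ-map-suc : ∀ xs → distinctᵇ (map suc xs) ≡ distinctᵇ xs
  distinctᵇ-map-suc []       = refl
  distinctᵇ-map-suc (y ∷ xs) = cong₂ _∧_ (cong not (elemᵇ-map-suc y xs)) (distinctᵇ-map-suc xs)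

  distinctᵇ-upTo : ∀ m → distinctᵇ (upTo m) ≡ true
  distinctᵇ-upTo zero = refl
  distinctᵇ-upTo (suc m) rewrite sym (map-upTo suc m) | elemᵇ-zero-map-suc (upTo m) | distinctᵇ-map-suc (upTo m) = distinctᵇ-upTo m

  matchingCount-copies : ∀ c m k → matchingCountℕ (copies c m) k ≡ countBelow c m C k
  matchingCount-copies c m k =
    trans (matchingCount-pairwiseDisjoint (copies c m) k
             (trans (pairwiseDisjoint-copyEdges (filterᵇ c (upTo m))) (distinctᵇ-filterᵇ c (upTo m) (distinctᵇ-upTo m))))
          (cong (_C k) (length-map copyEdge (filterᵇ c (upTo m))))

module FinEdges where

  open import Data.Bool using (Bool; true; false; _∧_; _∨_; not)
  open import Data.Fin using (Fin; toℕ)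
  open import Data.List using (List; []; _∷_; _++_; map; concatMap; filterᵇ; length; upTo; allFin; tabulate; applyUpTo)
  open import Data.List.Properties using (map-tabulate; map-concatMap; concatMap-map; concatMap-cong; map-++; length-map; map-∘)
  open import Data.Nat using (ℕ; zero; suc; _<ᵇ_; _≡ᵇ_)
  open import Data.Product using (_×_; _,_)
  open import Relation.Binary.PropositionalEquality
  open import Defs using (SimpleGraph; adj; edges; sublists; elemF; distinct; endpoints; isMatching; matchingCount)
  open Lists
  open Matchings

  edgeRow : ℕ → (ℕ → ℕ → Bool) → ℕ → List Edge
  edgeRow n φ i = map (i ,_) (filterᵇ (φ i) (upTo n))

  edgeListℕ : ℕ → (ℕ → ℕ → Bool) → List Edge
  edgeListℕ n φ = concatMap (edgeRow n (λ i j → (i <ᵇ j) ∧ φ i j)) (upTo n)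

  toℕ² : ∀ {n} → Fin n × Fin n → Edge
  toℕ² (i , j) = (toℕ i , toℕ j)

  sublists-map : ∀ {A B : Set} (f : A → B) xs → sublists (map f xs) ≡ map (map f) (sublists xs)
  sublists-map f [] = refl
  sublists-map f (x ∷ xs) rewrite sublists-map f xs
    | map-++ (map f) (sublists xs) (map (x ∷_) (sublists xs))
    | sym (map-∘ {g = map f} {f = x ∷_} (sublists xs)) | sym (map-∘ {g = f x ∷_} {f = map f} (sublists xs)) = refl

  isMatching-toℕ : ∀ {n} (es : List (Fin n × Fin n)) → isMatching es ≡ isMatchingℕ (map toℕ² es)
  isMatching-toℕ es = trans (distinct-toℕ (endpoints es)) (cong distinctᵇ (endpoints-toℕ es))
    where
    elemF-toℕ : ∀ {n} (i : Fin n) js → elemF i js ≡ elemᵇ (toℕ i) (map toℕ js)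
    elemF-toℕ i []       = refl
    elemF-toℕ i (j ∷ js) = cong ((toℕ i ≡ᵇ toℕ j) ∨_) (elemF-toℕ i js)
    distinct-toℕ : ∀ {n} (js : List (Fin n)) → distinct js ≡ distinctᵇ (map toℕ js)
    distinct-toℕ []       = refl
    distinct-toℕ (j ∷ js) = cong₂ (λ a b → not a ∧ b) (elemF-toℕ j js) (distinct-toℕ js)
    endpoints-toℕ : ∀ {n} (es : List (Fin n × Fin n)) → map toℕ (endpoints es) ≡ endpointsℕ (map toℕ² es)
    endpoints-toℕ []             = refl
    endpoints-toℕ ((i , j) ∷ es) = cong (λ vs → toℕ i ∷ toℕ j ∷ vs) (endpoints-toℕ es)

  matchingCount-toℕ : ∀ {n} (G : SimpleGraph n) k → matchingCount G k ≡ matchingCountℕ (map toℕ² (edges G)) k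
  matchingCount-toℕ G k = sym (begin
    length (filterᵇ ψ (sublists (map toℕ² (edges G))))
      ≡⟨ cong (λ L → length (filterᵇ ψ L)) (sublists-map toℕ² (edges G)) ⟩
    length (filterᵇ ψ (map (map toℕ²) (sublists (edges G))))
      ≡⟨ length-filterᵇ-map ψ (map toℕ²) (sublists (edges G)) ⟩
    length (filterᵇ (λ es → ψ (map toℕ² es)) (sublists (edges G)))
      ≡⟨ cong length (filterᵇ-cong (λ es → cong₂ _∧_ (sym (isMatching-toℕ es)) (cong (_≡ᵇ k) (length-map toℕ² es))) (sublists (edges G))) ⟩
    matchingCount G k ∎)
    where
    open ≡-Reasoning
    ψ : List Edge → Bool
    ψ es = isMatchingℕ es ∧ (length es ≡ᵇ k)

  map-filterᵇ : ∀ {A B : Set} (f : A → B) (p : A → Bool) (q : B → Bool) → (∀ x → p x ≡ q (f x)) →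
    ∀ xs → map f (filterᵇ p xs) ≡ filterᵇ q (map f xs)
  map-filterᵇ f p q p≗q∘f [] = refl
  map-filterᵇ f p q p≗q∘f (x ∷ xs) with p x | q (f x) | p≗q∘f x
  ... | true  | true  | refl = cong (f x ∷_) (map-filterᵇ f p q p≗q∘f xs)
  ... | false | false | refl = map-filterᵇ f p q p≗q∘f xs

  map-toℕ-allFin : ∀ n → map toℕ (allFin n) ≡ upTo n
  map-toℕ-allFin n = trans (map-tabulate (λ i → i) toℕ) (tabulate-toℕ n (λ x → x))
    where
    tabulate-toℕ : ∀ n (g : ℕ → ℕ) → tabulate {n = n} (λ i → g (toℕ i)) ≡ applyUpTo g n
    tabulate-toℕ zero    g = refl
    tabulate-toℕ (suc n) g = cong (g 0 ∷_) (tabulate-toℕ n (λ x → g (suc x)))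

  edges-toℕ : ∀ {n} (G : SimpleGraph n) (φ : ℕ → ℕ → Bool) → (∀ u v → adj G u v ≡ φ (toℕ u) (toℕ v)) →
    map toℕ² (edges G) ≡ edgeListℕ n φ
  edges-toℕ {n} G φ adj≗φ = begin
    map toℕ² (edges G)                            ≡⟨ map-concatMap toℕ² row (allFin n) ⟩
    concatMap (λ i → map toℕ² (row i)) (allFin n) ≡⟨ concatMap-cong row-toℕ (allFin n) ⟩
    concatMap (λ i → rowℕ (toℕ i)) (allFin n)     ≡⟨ concatMap-map rowℕ toℕ (allFin n) ⟨
    concatMap rowℕ (map toℕ (allFin n))           ≡⟨ cong (concatMap rowℕ) (map-toℕ-allFin n) ⟩
    edgeListℕ n φ                                 ∎
    where
    open ≡-Reasoning
    row : Fin n → List (Fin n × Fin n)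
    row i = map (λ j → (i , j)) (filterᵇ (λ j → (toℕ i <ᵇ toℕ j) ∧ adj G i j) (allFin n))
    rowℕ : ℕ → List Edge
    rowℕ = edgeRow n (λ i j → (i <ᵇ j) ∧ φ i j)
    row-toℕ : ∀ i → map toℕ² (row i) ≡ rowℕ (toℕ i)
    row-toℕ i = begin
      map toℕ² (row i)
        ≡⟨ map-∘ (filterᵇ (λ j → (toℕ i <ᵇ toℕ j) ∧ adj G i j) (allFin n)) ⟨
      map (λ j → (toℕ i , toℕ j)) (filterᵇ (λ j → (toℕ i <ᵇ toℕ j) ∧ adj G i j) (allFin n))
        ≡⟨ map-∘ (filterᵇ (λ j → (toℕ i <ᵇ toℕ j) ∧ adj G i j) (allFin n)) ⟩
      map (toℕ i ,_) (map toℕ (filterᵇ (λ j → (toℕ i <ᵇ toℕ j) ∧ adj G i j) (allFin n)))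
        ≡⟨ cong (map (toℕ i ,_)) (map-filterᵇ toℕ _ (λ y → (toℕ i <ᵇ y) ∧ φ (toℕ i) y)
                                    (λ j → cong ((toℕ i <ᵇ toℕ j) ∧_) (adj≗φ i j)) (allFin n)) ⟩
      map (toℕ i ,_) (filterᵇ (λ y → (toℕ i <ᵇ y) ∧ φ (toℕ i) y) (map toℕ (allFin n)))
        ≡⟨ cong (λ L → map (toℕ i ,_) (filterᵇ (λ y → (toℕ i <ᵇ y) ∧ φ (toℕ i) y) L)) (map-toℕ-allFin n) ⟩
      rowℕ (toℕ i) ∎

module HubGraphs where

  open import Data.Bool using (Bool; true; false; _∧_; _∨_; not; if_then_else_; T; T?)
  open import Data.Bool.ListAction using (all)
  open import Data.Bool.Properties using (∧-zeroʳ; ∧-identityʳ; ∧-idem)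
  open import Data.Empty using (⊥-elim)
  open import Data.List using (List; []; _∷_; map; concatMap; filterᵇ; length; upTo)
  open import Data.List.Properties using (length-map; concatMap-cong; filter-some)
  open import Data.Nat using (ℕ; suc; _+_; _*_; _<_; _≡ᵇ_; _<ᵇ_; ⌊_/2⌋)
  open import Data.Nat.Combinatorics using (_C_; nCk+nC[k+1]≡[n+1]C[k+1])
  open import Data.Nat.ListAction using (sum)
  open import Data.Nat.Properties using (+-comm; +-assoc; n<1+n; <-cmp; suc-injective; <⇒≢)
  open import Data.Nat.Tactic.RingSolver using (solve-∀)
  open import Data.Product using (_×_; _,_; proj₁; proj₂)
  open import Data.Sum using (_⊎_; inj₁; inj₂; [_,_]′)
  open import Relation.Binary.Definitions using (tri<; tri≈; tri>)
  open import Relation.Binary.PropositionalEquality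
  open import Data.List.Membership.Propositional using (_∈_)
  open import Data.List.Membership.Propositional.Properties using (∈-concatMap⁺; ∈-map⁺; ∈-filter⁺; ∈-upTo⁺)
  open import Data.List.Membership.Propositional.Properties.Core using (∃∈-Any)
  open import Function using (_∘_)
  open Lists
  open Matchings
  open Copies
  open FinEdges

  module HubGraph (m₂ w : ℕ) (S : ℕ → Bool)
                  (S-off-hub-copy : ∀ x → S x ≡ true → ⌊ x /2⌋ ≢ ⌊ w /2⌋)
                  (w<n : w < suc (suc m₂) * 2) where

    m n : ℕ
    m = suc (suc m₂)
    n = m * 2

    adjℕ : ℕ → ℕ → Bool
    adjℕ i j = ((⌊ i /2⌋ ≡ᵇ ⌊ j /2⌋) ∧ not (i ≡ᵇ j)) ∨ (((i ≡ᵇ w) ∧ S j) ∨ ((j ≡ᵇ w) ∧ S i))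

    edgesℕ : List Edge
    edgesℕ = edgeListℕ n adjℕ

    filterᵇ-edgesℕ : ∀ (φ : Edge → Bool) →
      filterᵇ φ edgesℕ ≡ concatMap (edgeRow n (λ i j → ((i <ᵇ j) ∧ adjℕ i j) ∧ φ (i , j))) (upTo n)
    filterᵇ-edgesℕ φ = trans (filterᵇ-concatMap φ (edgeRow n (λ i j → (i <ᵇ j) ∧ adjℕ i j)) (upTo n)) (concatMap-cong row (upTo n))
      where
      row : ∀ i → filterᵇ φ (edgeRow n (λ i j → (i <ᵇ j) ∧ adjℕ i j) i) ≡ edgeRow n (λ i j → ((i <ᵇ j) ∧ adjℕ i j) ∧ φ (i , j)) i
      row i = trans (filterᵇ-map φ (i ,_) (filterᵇ (λ j → (i <ᵇ j) ∧ adjℕ i j) (upTo n)))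
                    (cong (map (i ,_)) (filterᵇ-filterᵇ (λ j → φ (i , j)) (λ j → (i <ᵇ j) ∧ adjℕ i j) (upTo n)))

    filterᵇ-edgesℕ-copies : (φ : Edge → Bool) (c : ℕ → Bool) →
      (∀ i j → (((i <ᵇ j) ∧ adjℕ i j) ∧ φ (i , j)) ≡ ((j ≡ᵇ suc i) ∧ (even i ∧ c ⌊ i /2⌋))) →
      filterᵇ φ edgesℕ ≡ copies c m
    filterᵇ-edgesℕ-copies φ c φ-char = begin
        filterᵇ φ edgesℕ
          ≡⟨ filterᵇ-edgesℕ φ ⟩
        concatMap (edgeRow n (λ i j → ((i <ᵇ j) ∧ adjℕ i j) ∧ φ (i , j))) (upTo n)
          ≡⟨ concatMap-cong-upTo n _ _ row ⟩
        concatMap (λ i → if even i ∧ c ⌊ i /2⌋ then (i , suc i) ∷ [] else []) (upTo n)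
          ≡⟨ concatMap-copies m c ⟩
        copies c m ∎
      where
      open ≡-Reasoning
      row : ∀ i → i < n → edgeRow n (λ i j → ((i <ᵇ j) ∧ adjℕ i j) ∧ φ (i , j)) i
                          ≡ (if even i ∧ c ⌊ i /2⌋ then (i , suc i) ∷ [] else [])
      row i i<n rewrite filterᵇ-cong (φ-char i) (upTo n) with even i in ei
      ... | false rewrite filterᵇ-none (λ j → (j ≡ᵇ suc i) ∧ false) (upTo n) (λ j → ∧-zeroʳ (j ≡ᵇ suc i)) = refl
      ... | true rewrite filterᵇ-≡ᵇ∧-upTo n (suc i) (c ⌊ i /2⌋) (even⇒1+i<l*2 m ei i<n) with c ⌊ i /2⌋
      ...   | true  = refl
      ...   | false = refl

    adjℕ-off-hub⇒same-copy : ∀ i j → adjℕ i j ≡ true → i ≢ w → j ≢ w → ⌊ i /2⌋ ≡ ⌊ j /2⌋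
    adjℕ-off-hub⇒same-copy i j h i≢w j≢w with ∨-true⁻ {(⌊ i /2⌋ ≡ᵇ ⌊ j /2⌋) ∧ not (i ≡ᵇ j)} h
    ... | inj₁ copy-edge = ≡ᵇ-true⇒≡ (proj₁ (∧-true⁻ {⌊ i /2⌋ ≡ᵇ ⌊ j /2⌋} copy-edge))
    ... | inj₂ hub-edge with ∨-true⁻ {(i ≡ᵇ w) ∧ S j} hub-edge
    ...   | inj₁ i-hub = ⊥-elim (i≢w (≡ᵇ-true⇒≡ (proj₁ (∧-true⁻ {i ≡ᵇ w} i-hub))))
    ...   | inj₂ j-hub = ⊥-elim (j≢w (≡ᵇ-true⇒≡ (proj₁ (∧-true⁻ {j ≡ᵇ w} j-hub))))

    adjℕ-copy : ∀ i → even i ≡ true → adjℕ i (suc i) ≡ true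
    adjℕ-copy i ei = ∨-trueˡ _ (∧-true⁺ (≡⇒≡ᵇ-true (sym (⌊1+i/2⌋≡⌊i/2⌋ i ei))) (not-true⁺ (≢⇒≡ᵇ-false (<⇒≢ (n<1+n i)))))

    awayFrom : ℕ → ℕ → ℕ → Bool
    awayFrom a b x = not (x ≡ᵇ ⌊ a /2⌋) ∧ not (x ≡ᵇ ⌊ b /2⌋)

    deleteEnds-char : ∀ a b → w ≡ a ⊎ w ≡ b → ∀ i j →
      (((i <ᵇ j) ∧ adjℕ i j) ∧ disjoint (a , b) (i , j)) ≡ ((j ≡ᵇ suc i) ∧ (even i ∧ awayFrom a b ⌊ i /2⌋))
    deleteEnds-char a b w∈ab i j = true-ext to from
      where
      to : (((i <ᵇ j) ∧ adjℕ i j) ∧ disjoint (a , b) (i , j)) ≡ true → ((j ≡ᵇ suc i) ∧ (even i ∧ awayFrom a b ⌊ i /2⌋)) ≡ true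
      to h with ∧-true⁻ {(i <ᵇ j) ∧ adjℕ i j} h
      ... | edge , disj with ∧-true⁻ {i <ᵇ j} edge | ∧-true⁻ {avoids a (i , j)} disj
      ... | i<j , adj | a-avoid , b-avoid with avoids-true⁻ a i j a-avoid | avoids-true⁻ b i j b-avoid
      ... | a≢i , a≢j | b≢i , b≢j =
        ∧-true⁺ (≡⇒≡ᵇ-true (proj₂ copy-ij)) (∧-true⁺ (proj₁ copy-ij) (∧-true⁺ (not-true⁺ (≢⇒≡ᵇ-false (other-copy a a≢i a≢j)))
                                                                          (not-true⁺ (≢⇒≡ᵇ-false (other-copy b b≢i b≢j)))))
        where
        w≢ : ∀ x → a ≢ x → b ≢ x → w ≢ x
        w≢ x a≢x b≢x w≡x = [ (λ w≡a → a≢x (trans (sym w≡a) w≡x)) , (λ w≡b → b≢x (trans (sym w≡b) w≡x)) ]′ w∈ab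
        copy-ij : even i ≡ true × j ≡ suc i
        copy-ij = same-copy-< (<ᵇ-true⇒< i<j)
                    (adjℕ-off-hub⇒same-copy i j adj (λ e → w≢ i a≢i b≢i (sym e)) (λ e → w≢ j a≢j b≢j (sym e)))
        other-copy : ∀ x → x ≢ i → x ≢ j → ⌊ i /2⌋ ≢ ⌊ x /2⌋
        other-copy x x≢i x≢j e with same-copy (proj₁ copy-ij) (sym e)
        ... | inj₁ x≡i = x≢i x≡i
        ... | inj₂ x≡1+i = x≢j (trans x≡1+i (sym (proj₂ copy-ij)))
      from : ((j ≡ᵇ suc i) ∧ (even i ∧ awayFrom a b ⌊ i /2⌋)) ≡ true → (((i <ᵇ j) ∧ adjℕ i j) ∧ disjoint (a , b) (i , j)) ≡ true
      from h with ∧-true⁻ {j ≡ᵇ suc i} h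
      ... | j≡ , h′ with ∧-true⁻ {even i} h′
      ... | ei , away with ∧-true⁻ {not (⌊ i /2⌋ ≡ᵇ ⌊ a /2⌋)} away
      ... | a-away , b-away rewrite ≡ᵇ-true⇒≡ {j} {suc i} j≡ =
        ∧-true⁺ (∧-true⁺ (<⇒<ᵇ-true (n<1+n i)) (adjℕ-copy i ei))
                (∧-true⁺ (copy-avoids a (≡ᵇ-false⇒≢ (not-true⁻ a-away))) (copy-avoids b (≡ᵇ-false⇒≢ (not-true⁻ b-away))))
        where
        copy-avoids : ∀ x → ⌊ i /2⌋ ≢ ⌊ x /2⌋ → avoids x (i , suc i) ≡ true
        copy-avoids x e = avoids-true⁺ x i (suc i) (λ x≡i → e (cong ⌊_/2⌋ (sym x≡i)))
                                                   (λ x≡1+i → e (trans (sym (⌊1+i/2⌋≡⌊i/2⌋ i ei)) (cong ⌊_/2⌋ (sym x≡1+i))))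

    withinCopy : Edge → Bool
    withinCopy (a , b) = ⌊ a /2⌋ ≡ᵇ ⌊ b /2⌋

    hub-copy-char : ∀ i j → (((i <ᵇ j) ∧ adjℕ i j) ∧ (touches w (i , j) ∧ withinCopy (i , j)))
                            ≡ ((j ≡ᵇ suc i) ∧ (even i ∧ (⌊ i /2⌋ ≡ᵇ ⌊ w /2⌋)))
    hub-copy-char i j = true-ext to from
      where
      to : (((i <ᵇ j) ∧ adjℕ i j) ∧ (touches w (i , j) ∧ withinCopy (i , j))) ≡ true
         → ((j ≡ᵇ suc i) ∧ (even i ∧ (⌊ i /2⌋ ≡ᵇ ⌊ w /2⌋))) ≡ true
      to h with ∧-true⁻ {(i <ᵇ j) ∧ adjℕ i j} h
      ... | edge , hub with ∧-true⁻ {i <ᵇ j} edge | ∧-true⁻ {touches w (i , j)} hub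
      ... | i<j , _ | w-ij , within = ∧-true⁺ (≡⇒≡ᵇ-true (proj₂ copy-ij)) (∧-true⁺ (proj₁ copy-ij) (≡⇒≡ᵇ-true w-copy))
        where
        copy-ij : even i ≡ true × j ≡ suc i
        copy-ij = same-copy-< (<ᵇ-true⇒< i<j) (≡ᵇ-true⇒≡ within)
        w-copy : ⌊ i /2⌋ ≡ ⌊ w /2⌋
        w-copy with touches⇒end w i j w-ij
        ... | inj₁ w≡i = cong ⌊_/2⌋ (sym w≡i)
        ... | inj₂ w≡j = trans (≡ᵇ-true⇒≡ within) (cong ⌊_/2⌋ (sym w≡j))
      from : ((j ≡ᵇ suc i) ∧ (even i ∧ (⌊ i /2⌋ ≡ᵇ ⌊ w /2⌋))) ≡ true
           → (((i <ᵇ j) ∧ adjℕ i j) ∧ (touches w (i , j) ∧ withinCopy (i , j))) ≡ true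
      from h with ∧-true⁻ {j ≡ᵇ suc i} h
      ... | j≡ , h′ with ∧-true⁻ {even i} h′
      ... | ei , w-copy rewrite ≡ᵇ-true⇒≡ {j} {suc i} j≡ =
        ∧-true⁺ (∧-true⁺ (<⇒<ᵇ-true (n<1+n i)) (adjℕ-copy i ei))
                (∧-true⁺ (end⇒touches w i (suc i) (same-copy ei (sym (≡ᵇ-true⇒≡ w-copy))))
                         (≡⇒≡ᵇ-true (sym (⌊1+i/2⌋≡⌊i/2⌋ i ei))))

    filterᵇ-edgesℕ-all : ∀ (φ : Edge → Bool) → (∀ i j → i < n → j < n → (i <ᵇ j) ≡ true → φ (i , j) ≡ true) →
      filterᵇ φ edgesℕ ≡ edgesℕ
    filterᵇ-edgesℕ-all φ φ-edges =
      trans (filterᵇ-edgesℕ φ) (concatMap-cong-upTo n _ _ (λ i i<n → cong (map (i ,_)) (filterᵇ-cong-upTo n _ _ (keep i i<n))))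
      where
      keep : ∀ i → i < n → ∀ j → j < n → (((i <ᵇ j) ∧ adjℕ i j) ∧ φ (i , j)) ≡ ((i <ᵇ j) ∧ adjℕ i j)
      keep i i<n j j<n with i <ᵇ j in i<j
      ... | false = refl
      ... | true rewrite φ-edges i j i<n j<n i<j = ∧-identityʳ (adjℕ i j)

    bounded : Edge → Bool
    bounded (a , b) = (a <ᵇ n) ∧ (b <ᵇ n)

    edgesℕ-bounded : filterᵇ bounded edgesℕ ≡ edgesℕ
    edgesℕ-bounded = filterᵇ-edgesℕ-all bounded (λ i j i<n j<n _ → ∧-true⁺ (<⇒<ᵇ-true i<n) (<⇒<ᵇ-true j<n))

    edgesℕ-nonLoop : all nonLoop edgesℕ ≡ true
    edgesℕ-nonLoop = subst (λ E → all nonLoop E ≡ true)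
                           (filterᵇ-edgesℕ-all nonLoop (λ i j _ _ i<j → not-true⁺ (≢⇒≡ᵇ-false {i} {j} (<⇒≢ (<ᵇ-true⇒< {i} {j} i<j)))))
                           (all-filterᵇ-self nonLoop edgesℕ)

    deleteEnds-edgesℕ : ∀ a b → w ≡ a ⊎ w ≡ b → deleteEnds (a , b) edgesℕ ≡ copies (awayFrom a b) m
    deleteEnds-edgesℕ a b w∈ab = filterᵇ-edgesℕ-copies (disjoint (a , b)) (awayFrom a b) (deleteEnds-char a b w∈ab)

    matchingCount-deleteEnds : ∀ a b → w ≡ a ⊎ w ≡ b → ∀ k →
      matchingCountℕ (deleteEnds (a , b) edgesℕ) k ≡ countBelow (awayFrom a b) m C k
    matchingCount-deleteEnds a b w∈ab k = trans (cong (λ E → matchingCountℕ E k) (deleteEnds-edgesℕ a b w∈ab))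
                                                (matchingCount-copies (awayFrom a b) m k)

    countBelow-awayFrom-hub : ∀ a b → ⌊ a /2⌋ ≡ ⌊ w /2⌋ → ⌊ b /2⌋ ≡ ⌊ w /2⌋ → countBelow (awayFrom a b) m ≡ suc m₂
    countBelow-awayFrom-hub a b a-hub b-hub = suc-injective (trans (+-comm 1 _) (begin
      countBelow (awayFrom a b) m + 1                  ≡⟨ cong (λ L → length L + 1) (filterᵇ-cong away≐ (upTo m)) ⟩
      countBelow (λ x → true ∧ not (x ≡ᵇ ⌊ w /2⌋)) m + 1 ≡⟨ countBelow-remove (λ _ → true) m ⌊ w /2⌋ (⌊i/2⌋<l m w<n) refl ⟩
      countBelow (λ _ → true) m                        ≡⟨ countBelow-true m ⟩
      m                                                ∎))
      where
      open ≡-Reasoning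
      away≐ : ∀ x → awayFrom a b x ≡ not (x ≡ᵇ ⌊ w /2⌋)
      away≐ x rewrite a-hub | b-hub = ∧-idem _

    countBelow-awayFrom-spoke : ∀ a b → ⌊ a /2⌋ ≢ ⌊ b /2⌋ → a < n → b < n → countBelow (awayFrom a b) m ≡ m₂
    countBelow-awayFrom-spoke a b a≁b a<n b<n = suc-injective (suc-injective (trans (+-comm 2 _) (begin
      countBelow (awayFrom a b) m + 2                                   ≡⟨ +-assoc _ 1 1 ⟨
      countBelow (λ x → not (x ≡ᵇ ⌊ a /2⌋) ∧ not (x ≡ᵇ ⌊ b /2⌋)) m + 1 + 1
        ≡⟨ cong (_+ 1) (countBelow-remove (λ x → not (x ≡ᵇ ⌊ a /2⌋)) m ⌊ b /2⌋ (⌊i/2⌋<l m b<n)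
                                          (not-true⁺ (≢⇒≡ᵇ-false (λ e → a≁b (sym e))))) ⟩
      countBelow (λ x → true ∧ not (x ≡ᵇ ⌊ a /2⌋)) m + 1                ≡⟨ countBelow-remove (λ _ → true) m ⌊ a /2⌋ (⌊i/2⌋<l m a<n) refl ⟩
      countBelow (λ _ → true) m                                         ≡⟨ countBelow-true m ⟩
      m                                                                 ∎)))
      where open ≡-Reasoning

    hub-copy-edges : filterᵇ (λ f → touches w f ∧ withinCopy f) edgesℕ ≡ copies (_≡ᵇ ⌊ w /2⌋) m
    hub-copy-edges = filterᵇ-edgesℕ-copies (λ f → touches w f ∧ withinCopy f) (_≡ᵇ ⌊ w /2⌋) hub-copy-char

    length-hub-copy-edges : length (filterᵇ (λ f → touches w f ∧ withinCopy f) edgesℕ) ≡ 1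
    length-hub-copy-edges = begin
      length (filterᵇ (λ f → touches w f ∧ withinCopy f) edgesℕ)  ≡⟨ cong length hub-copy-edges ⟩
      length (copies (_≡ᵇ ⌊ w /2⌋) m)                             ≡⟨ length-map copyEdge (filterᵇ (_≡ᵇ ⌊ w /2⌋) (upTo m)) ⟩
      length (filterᵇ (_≡ᵇ ⌊ w /2⌋) (upTo m))                     ≡⟨ cong length (filterᵇ-≡ᵇ-upTo m ⌊ w /2⌋ (⌊i/2⌋<l m w<n)) ⟩
      1                                                           ∎
      where open ≡-Reasoning

    -- Every edge is bounded; the conjunct records that the ends of a spoke are below n.
    isSpoke : Edge → Bool
    isSpoke f = (bounded f ∧ touches w f) ∧ not (withinCopy f)

    spokes : List Edge
    spokes = filterᵇ isSpoke edgesℕ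

    spokes-split : filterᵇ (λ f → not (withinCopy f)) (filterᵇ (touches w) edgesℕ) ≡ spokes
    spokes-split = begin
      filterᵇ (λ f → not (withinCopy f)) (filterᵇ (touches w) edgesℕ)
        ≡⟨ cong (λ E → filterᵇ (λ f → not (withinCopy f)) (filterᵇ (touches w) E)) edgesℕ-bounded ⟨
      filterᵇ (λ f → not (withinCopy f)) (filterᵇ (touches w) (filterᵇ bounded edgesℕ))
        ≡⟨ cong (filterᵇ (λ f → not (withinCopy f))) (filterᵇ-filterᵇ (touches w) bounded edgesℕ) ⟩
      filterᵇ (λ f → not (withinCopy f)) (filterᵇ (λ f → bounded f ∧ touches w f) edgesℕ)
        ≡⟨ filterᵇ-filterᵇ (λ f → not (withinCopy f)) (λ f → bounded f ∧ touches w f) edgesℕ ⟩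
      spokes ∎
      where open ≡-Reasoning

    matchingCount-edgesℕ-suc : ∀ k → matchingCountℕ edgesℕ (suc k) ≡ m C suc k + length spokes * (m₂ C k)
    matchingCount-edgesℕ-suc k = begin
        matchingCountℕ edgesℕ (suc k)
          ≡⟨ matchingCount-star w edgesℕ edgesℕ-nonLoop (suc k) ⟩
        matchingCountℕ (deleteEnds (w , w) edgesℕ) (suc k) + sum (map g atHub)
          ≡⟨ cong₂ _+_ (trans (matchingCount-deleteEnds w w (inj₁ refl) (suc k)) (cong (_C suc k) (countBelow-awayFrom-hub w w refl refl)))
                       (sum-map-split withinCopy g atHub) ⟩
        suc m₂ C suc k + (sum (map g (filterᵇ withinCopy atHub)) + sum (map g (filterᵇ (λ f → not (withinCopy f)) atHub)))
          ≡⟨ cong (suc m₂ C suc k +_) (cong₂ _+_ hub-copy-term spokes-term) ⟩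
        suc m₂ C suc k + (1 * (suc m₂ C k) + length spokes * (m₂ C k))
          ≡⟨ regroup (suc m₂ C suc k) (suc m₂ C k) (length spokes * (m₂ C k)) ⟩
        (suc m₂ C k + suc m₂ C suc k) + length spokes * (m₂ C k)
          ≡⟨ cong (_+ length spokes * (m₂ C k)) (nCk+nC[k+1]≡[n+1]C[k+1] (suc m₂) k) ⟩
        m C suc k + length spokes * (m₂ C k) ∎
      where
      open ≡-Reasoning
      atHub : List Edge
      atHub = filterᵇ (touches w) edgesℕ
      g : Edge → ℕ
      g f = matchingCountℕ (deleteEnds f edgesℕ) k
      regroup : ∀ x y z → x + (1 * y + z) ≡ (y + x) + z
      regroup = solve-∀
      hub-copy-term : sum (map g (filterᵇ withinCopy atHub)) ≡ 1 * (suc m₂ C k)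
      hub-copy-term = begin
        sum (map g (filterᵇ withinCopy atHub))
          ≡⟨ cong (λ E → sum (map g E)) (filterᵇ-filterᵇ withinCopy (touches w) edgesℕ) ⟩
        sum (map g (filterᵇ (λ f → touches w f ∧ withinCopy f) edgesℕ))
          ≡⟨ sum-map-const-filterᵇ (λ f → touches w f ∧ withinCopy f) g (suc m₂ C k) edgesℕ count ⟩
        length (filterᵇ (λ f → touches w f ∧ withinCopy f) edgesℕ) * (suc m₂ C k)
          ≡⟨ cong (λ x → x * (suc m₂ C k)) length-hub-copy-edges ⟩
        1 * (suc m₂ C k) ∎
        where
        count : ∀ f → (touches w f ∧ withinCopy f) ≡ true → g f ≡ suc m₂ C k
        count (a , b) h with ∧-true⁻ {touches w (a , b)} h
        ... | w-ab , within = trans (matchingCount-deleteEnds a b w∈ab k) (cong (_C k) (countBelow-awayFrom-hub a b a-hub b-hub))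
          where
          w∈ab : w ≡ a ⊎ w ≡ b
          w∈ab = touches⇒end w a b w-ab
          a-hub : ⌊ a /2⌋ ≡ ⌊ w /2⌋
          a-hub = [ (λ w≡a → cong ⌊_/2⌋ (sym w≡a)) , (λ w≡b → trans (≡ᵇ-true⇒≡ within) (cong ⌊_/2⌋ (sym w≡b))) ]′ w∈ab
          b-hub : ⌊ b /2⌋ ≡ ⌊ w /2⌋
          b-hub = trans (sym (≡ᵇ-true⇒≡ within)) a-hub
      spokes-term : sum (map g (filterᵇ (λ f → not (withinCopy f)) atHub)) ≡ length spokes * (m₂ C k)
      spokes-term = begin
        sum (map g (filterᵇ (λ f → not (withinCopy f)) atHub)) ≡⟨ cong (λ E → sum (map g E)) spokes-split ⟩
        sum (map g spokes)                                    ≡⟨ sum-map-const-filterᵇ isSpoke g (m₂ C k) edgesℕ count ⟩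
        length spokes * (m₂ C k)                                ∎
        where
        count : ∀ f → isSpoke f ≡ true → g f ≡ m₂ C k
        count (a , b) h with ∧-true⁻ {bounded (a , b) ∧ touches w (a , b)} h
        ... | bounded∧touches , not-within with ∧-true⁻ {bounded (a , b)} bounded∧touches
        ... | a<n∧b<n , w-ab with ∧-true⁻ {a <ᵇ n} a<n∧b<n
        ... | a<n , b<n = trans (matchingCount-deleteEnds a b (touches⇒end w a b w-ab) k)
                                (cong (_C k) (countBelow-awayFrom-spoke a b (≡ᵇ-false⇒≢ (not-true⁻ not-within))
                                                                        (<ᵇ-true⇒< a<n) (<ᵇ-true⇒< b<n)))

    matchingCount-edgesℕ-zero : matchingCountℕ edgesℕ 0 ≡ 1
    matchingCount-edgesℕ-zero = matchingCount-zero edgesℕ edgesℕ-nonLoop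

    edge∈edgesℕ : ∀ i j → i < n → j < n → ((i <ᵇ j) ∧ adjℕ i j) ≡ true → (i , j) ∈ edgesℕ
    edge∈edgesℕ i j i<n j<n ij =
      ∈-concatMap⁺ (edgeRow n (λ i j → (i <ᵇ j) ∧ adjℕ i j))
        (∃∈-Any (i , ∈-upTo⁺ i<n , ∈-map⁺ (i ,_) (∈-filter⁺ (T? ∘ (λ j → (i <ᵇ j) ∧ adjℕ i j)) (∈-upTo⁺ j<n) (≡true⇒T ij))))

    spokes-nonempty : ∀ v → v < n → S v ≡ true → 0 < length spokes
    spokes-nonempty v v<n Sv with <-cmp w v
    ... | tri< w<v _ _ = filter-some (T? ∘ isSpoke) (∃∈-Any ((w , v) , edge∈edgesℕ w v w<n v<n (∧-true⁺ (<⇒<ᵇ-true w<v) adj) , spoke))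
      where
      adj : adjℕ w v ≡ true
      adj = ∨-trueʳ ((⌊ w /2⌋ ≡ᵇ ⌊ v /2⌋) ∧ not (w ≡ᵇ v)) (∨-trueˡ ((v ≡ᵇ w) ∧ S w) (∧-true⁺ (≡ᵇ-refl w) Sv))
      spoke : T (isSpoke (w , v))
      spoke = ≡true⇒T (∧-true⁺ (∧-true⁺ (∧-true⁺ (<⇒<ᵇ-true w<n) (<⇒<ᵇ-true v<n)) (end⇒touches w w v (inj₁ refl)))
                               (not-true⁺ (≢⇒≡ᵇ-false (λ e → S-off-hub-copy v Sv (sym e)))))
    ... | tri≈ _ w≡v _ = ⊥-elim (S-off-hub-copy v Sv (cong ⌊_/2⌋ (sym w≡v)))
    ... | tri> _ _ v<w = filter-some (T? ∘ isSpoke) (∃∈-Any ((v , w) , edge∈edgesℕ v w v<n w<n (∧-true⁺ (<⇒<ᵇ-true v<w) adj) , spoke))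
      where
      adj : adjℕ v w ≡ true
      adj = ∨-trueʳ ((⌊ v /2⌋ ≡ᵇ ⌊ w /2⌋) ∧ not (v ≡ᵇ w)) (∨-trueʳ ((v ≡ᵇ w) ∧ S w) (∧-true⁺ (≡ᵇ-refl w) Sv))
      spoke : T (isSpoke (v , w))
      spoke = ≡true⇒T (∧-true⁺ (∧-true⁺ (∧-true⁺ (<⇒<ᵇ-true v<n) (<⇒<ᵇ-true w<n)) (end⇒touches w v w (inj₂ refl)))
                               (not-true⁺ (≢⇒≡ᵇ-false (S-off-hub-copy v Sv))))

module Polynomials where

  open import Data.Nat as ℕ using (zero; suc)
  open import Data.Integer as ℤ using (ℤ; +_; _+_; _*_; -_; _^_; NonZero)
  open import Data.Integer.Properties using (+-identityˡ; +-identityʳ; *-zeroˡ; *-zeroʳ; *-cancelˡ-≡; i*j≡0⇒i≡0∨j≡0; neg-injective; neg-distribˡ-*)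
  open import Data.Integer.Tactic.RingSolver using (solve-∀)
  open import Data.List using ([]; _∷_; map)
  open import Data.Sum using (inj₁; inj₂)
  open import Relation.Binary.PropositionalEquality
  open import Relation.Nullary using (¬_)
  open import Defs using (Poly; coeff; _+ₚ_; _*ₚ_; _^ₚ_; X-_; _∣ₚ_; RootMult)
  open import Data.Product using (_,_)

  infix 4 _≈_
  record _≈_ (p q : Poly) : Set where
    constructor coeffwise
    field coeff≡ : ∀ i → coeff p i ≡ coeff q i
  open _≈_ public

  ≈-refl : ∀ {p} → p ≈ p
  ≈-refl = coeffwise λ _ → refl

  ≈-sym : ∀ {p q} → p ≈ q → q ≈ p
  ≈-sym p≈q = coeffwise λ i → sym (coeff≡ p≈q i)

  ≈-trans : ∀ {p q r} → p ≈ q → q ≈ r → p ≈ r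
  ≈-trans p≈q q≈r = coeffwise λ i → trans (coeff≡ p≈q i) (coeff≡ q≈r i)

  module ≈-Reasoning where
    infix  1 begin_
    infixr 2 _≈⟨_⟩_ _≈⟨_⟨_
    infix  3 _∎

    begin_ : ∀ {p q} → p ≈ q → p ≈ q
    begin p≈q = p≈q

    _≈⟨_⟩_ : ∀ p {q r} → p ≈ q → q ≈ r → p ≈ r
    _ ≈⟨ p≈q ⟩ q≈r = ≈-trans p≈q q≈r

    _≈⟨_⟨_ : ∀ p {q r} → q ≈ p → q ≈ r → p ≈ r
    _ ≈⟨ q≈p ⟨ q≈r = ≈-trans (≈-sym q≈p) q≈r

    _∎ : ∀ p → p ≈ p
    _ ∎ = ≈-refl

  coeff-+ₚ : ∀ p q i → coeff (p +ₚ q) i ≡ coeff p i + coeff q i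
  coeff-+ₚ []      q       i       = sym (+-identityˡ (coeff q i))
  coeff-+ₚ (a ∷ p) []      zero    = sym (+-identityʳ a)
  coeff-+ₚ (a ∷ p) []      (suc i) = sym (+-identityʳ (coeff p i))
  coeff-+ₚ (a ∷ p) (b ∷ q) zero    = refl
  coeff-+ₚ (a ∷ p) (b ∷ q) (suc i) = coeff-+ₚ p q i

  coeff-map-* : ∀ a p i → coeff (map (a *_) p) i ≡ a * coeff p i
  coeff-map-* a []      i       = sym (*-zeroʳ a)
  coeff-map-* a (b ∷ p) zero    = refl
  coeff-map-* a (b ∷ p) (suc i) = coeff-map-* a p i

  coeff-∷-*ₚ : ∀ a p q i → coeff ((a ∷ p) *ₚ q) i ≡ a * coeff q i + coeff (+ 0 ∷ (p *ₚ q)) i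
  coeff-∷-*ₚ a p q i = trans (coeff-+ₚ (map (a *_) q) (+ 0 ∷ (p *ₚ q)) i) (cong (_+ coeff (+ 0 ∷ (p *ₚ q)) i) (coeff-map-* a q i))

  +ₚ-cong : ∀ {p p′ q q′} → p ≈ p′ → q ≈ q′ → p +ₚ q ≈ p′ +ₚ q′
  +ₚ-cong {p} {p′} {q} {q′} p≈p′ q≈q′ =
    coeffwise λ i → trans (coeff-+ₚ p q i) (trans (cong₂ _+_ (coeff≡ p≈p′ i) (coeff≡ q≈q′ i)) (sym (coeff-+ₚ p′ q′ i)))

  ∷-cong : ∀ {a p q} → p ≈ q → a ∷ p ≈ a ∷ q
  ∷-cong p≈q = coeffwise λ { zero → refl ; (suc i) → coeff≡ p≈q i }

  *ₚ-congˡ : ∀ p {q q′} → q ≈ q′ → p *ₚ q ≈ p *ₚ q′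
  *ₚ-congˡ []      q≈q′ = ≈-refl
  *ₚ-congˡ (a ∷ p) {q} {q′} q≈q′ = coeffwise λ i → begin
    coeff ((a ∷ p) *ₚ q) i                       ≡⟨ coeff-∷-*ₚ a p q i ⟩
    a * coeff q i + coeff (+ 0 ∷ (p *ₚ q)) i     ≡⟨ cong₂ _+_ (cong (a *_) (coeff≡ q≈q′ i)) (coeff≡ (∷-cong (*ₚ-congˡ p q≈q′)) i) ⟩
    a * coeff q′ i + coeff (+ 0 ∷ (p *ₚ q′)) i   ≡⟨ coeff-∷-*ₚ a p q′ i ⟨
    coeff ((a ∷ p) *ₚ q′) i                      ∎
    where open ≡-Reasoning

  *ₚ-zeroʳ : ∀ p → p *ₚ [] ≈ []
  *ₚ-zeroʳ []      = ≈-refl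
  *ₚ-zeroʳ (a ∷ p) = coeffwise λ { zero → refl ; (suc i) → coeff≡ (*ₚ-zeroʳ p) i }

  *ₚ-∷ʳ : ∀ q a p → q *ₚ (a ∷ p) ≈ map (a *_) q +ₚ (+ 0 ∷ (q *ₚ p))
  *ₚ-∷ʳ []      a p = coeffwise λ { zero → refl ; (suc i) → refl }
  *ₚ-∷ʳ (b ∷ q) a p = coeffwise λ
    { zero → trans (coeff-∷-*ₚ b q (a ∷ p) zero) (trans (comm₀ b a) (sym (coeff-+ₚ (map (a *_) (b ∷ q)) (+ 0 ∷ ((b ∷ q) *ₚ p)) zero)))
    ; (suc i) → begin
        coeff ((b ∷ q) *ₚ (a ∷ p)) (suc i)
          ≡⟨ coeff-∷-*ₚ b q (a ∷ p) (suc i) ⟩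
        b * coeff p i + coeff (q *ₚ (a ∷ p)) i
          ≡⟨ cong (λ z → b * coeff p i + z) (trans (coeff≡ (*ₚ-∷ʳ q a p) i) (coeff-∷-*ₚ′ i)) ⟩
        b * coeff p i + (a * coeff q i + coeff (+ 0 ∷ (q *ₚ p)) i)
          ≡⟨ swap (b * coeff p i) (a * coeff q i) (coeff (+ 0 ∷ (q *ₚ p)) i) ⟩
        a * coeff q i + (b * coeff p i + coeff (+ 0 ∷ (q *ₚ p)) i)
          ≡⟨ cong₂ _+_ (sym (coeff-map-* a q i)) (sym (coeff-∷-*ₚ b q p i)) ⟩
        coeff (map (a *_) q) i + coeff ((b ∷ q) *ₚ p) i
          ≡⟨ coeff-+ₚ (map (a *_) q) ((b ∷ q) *ₚ p) i ⟨
        coeff (map (a *_) (b ∷ q) +ₚ (+ 0 ∷ ((b ∷ q) *ₚ p))) (suc i) ∎ }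
    where
    open ≡-Reasoning
    comm₀ : ∀ b a → b * a + + 0 ≡ a * b + + 0
    comm₀ = solve-∀
    swap : ∀ x y z → x + (y + z) ≡ y + (x + z)
    swap = solve-∀
    coeff-∷-*ₚ′ : ∀ i → coeff (map (a *_) q +ₚ (+ 0 ∷ (q *ₚ p))) i ≡ a * coeff q i + coeff (+ 0 ∷ (q *ₚ p)) i
    coeff-∷-*ₚ′ i = trans (coeff-+ₚ (map (a *_) q) _ i) (cong (_+ coeff (+ 0 ∷ (q *ₚ p)) i) (coeff-map-* a q i))

  *ₚ-comm : ∀ p q → p *ₚ q ≈ q *ₚ p
  *ₚ-comm []      q = ≈-sym (*ₚ-zeroʳ q)
  *ₚ-comm (a ∷ p) q = ≈-trans (+ₚ-cong {map (a *_) q} ≈-refl (∷-cong (*ₚ-comm p q))) (≈-sym (*ₚ-∷ʳ q a p))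

  *ₚ-congʳ : ∀ {p p′} q → p ≈ p′ → p *ₚ q ≈ p′ *ₚ q
  *ₚ-congʳ {p} {p′} q p≈p′ = ≈-trans (*ₚ-comm p q) (≈-trans (*ₚ-congˡ q p≈p′) (*ₚ-comm q p′))

  *ₚ-distribˡ : ∀ r p q → r *ₚ (p +ₚ q) ≈ (r *ₚ p) +ₚ (r *ₚ q)
  *ₚ-distribˡ []      p q = ≈-refl
  *ₚ-distribˡ (c ∷ r) p q = coeffwise λ i → begin
      coeff ((c ∷ r) *ₚ (p +ₚ q)) i
        ≡⟨ coeff-∷-*ₚ c r (p +ₚ q) i ⟩
      c * coeff (p +ₚ q) i + coeff (+ 0 ∷ (r *ₚ (p +ₚ q))) i
        ≡⟨ cong₂ _+_ (cong (c *_) (coeff-+ₚ p q i)) (tail i) ⟩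
      c * (coeff p i + coeff q i) + (coeff (+ 0 ∷ (r *ₚ p)) i + coeff (+ 0 ∷ (r *ₚ q)) i)
        ≡⟨ interchange c (coeff p i) (coeff q i) _ _ ⟩
      (c * coeff p i + coeff (+ 0 ∷ (r *ₚ p)) i) + (c * coeff q i + coeff (+ 0 ∷ (r *ₚ q)) i)
        ≡⟨ cong₂ _+_ (coeff-∷-*ₚ c r p i) (coeff-∷-*ₚ c r q i) ⟨
      coeff ((c ∷ r) *ₚ p) i + coeff ((c ∷ r) *ₚ q) i
        ≡⟨ coeff-+ₚ ((c ∷ r) *ₚ p) ((c ∷ r) *ₚ q) i ⟨
      coeff (((c ∷ r) *ₚ p) +ₚ ((c ∷ r) *ₚ q)) i ∎
    where
    open ≡-Reasoning
    interchange : ∀ c a b u v → c * (a + b) + (u + v) ≡ (c * a + u) + (c * b + v)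
    interchange = solve-∀
    tail : ∀ i → coeff (+ 0 ∷ (r *ₚ (p +ₚ q))) i ≡ coeff (+ 0 ∷ (r *ₚ p)) i + coeff (+ 0 ∷ (r *ₚ q)) i
    tail zero    = refl
    tail (suc i) = trans (coeff≡ (*ₚ-distribˡ r p q) i) (coeff-+ₚ (r *ₚ p) (r *ₚ q) i)

  *ₚ-distribʳ : ∀ p q r → (p +ₚ q) *ₚ r ≈ (p *ₚ r) +ₚ (q *ₚ r)
  *ₚ-distribʳ p q r = ≈-trans (*ₚ-comm (p +ₚ q) r) (≈-trans (*ₚ-distribˡ r p q) (+ₚ-cong (*ₚ-comm r p) (*ₚ-comm r q)))

  map-*-*ₚ : ∀ a q r → map (a *_) q *ₚ r ≈ map (a *_) (q *ₚ r)
  map-*-*ₚ a []      r = ≈-refl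
  map-*-*ₚ a (b ∷ q) r = coeffwise λ i → begin
      coeff (map (a *_) (b ∷ q) *ₚ r) i
        ≡⟨ coeff-∷-*ₚ (a * b) (map (a *_) q) r i ⟩
      a * b * coeff r i + coeff (+ 0 ∷ (map (a *_) q *ₚ r)) i
        ≡⟨ cong (λ z → a * b * coeff r i + z) (tail i) ⟩
      a * b * coeff r i + a * coeff (+ 0 ∷ (q *ₚ r)) i
        ≡⟨ factor a b (coeff r i) _ ⟩
      a * (b * coeff r i + coeff (+ 0 ∷ (q *ₚ r)) i)
        ≡⟨ cong (a *_) (coeff-∷-*ₚ b q r i) ⟨
      a * coeff ((b ∷ q) *ₚ r) i
        ≡⟨ coeff-map-* a ((b ∷ q) *ₚ r) i ⟨
      coeff (map (a *_) ((b ∷ q) *ₚ r)) i ∎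
    where
    open ≡-Reasoning
    factor : ∀ a b x y → a * b * x + a * y ≡ a * (b * x + y)
    factor = solve-∀
    tail : ∀ i → coeff (+ 0 ∷ (map (a *_) q *ₚ r)) i ≡ a * coeff (+ 0 ∷ (q *ₚ r)) i
    tail zero    = sym (*-zeroʳ a)
    tail (suc i) = trans (coeff≡ (map-*-*ₚ a q r) i) (coeff-map-* a (q *ₚ r) i)

  0∷-*ₚ : ∀ p r → (+ 0 ∷ p) *ₚ r ≈ + 0 ∷ (p *ₚ r)
  0∷-*ₚ p r = coeffwise λ i →
    trans (coeff-∷-*ₚ (+ 0) p r i) (trans (cong (_+ coeff (+ 0 ∷ (p *ₚ r)) i) (*-zeroˡ (coeff r i))) (+-identityˡ _))

  *ₚ-assoc : ∀ p q r → (p *ₚ q) *ₚ r ≈ p *ₚ (q *ₚ r)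
  *ₚ-assoc []      q r = ≈-refl
  *ₚ-assoc (a ∷ p) q r =
    ≈-trans (*ₚ-distribʳ (map (a *_) q) (+ 0 ∷ (p *ₚ q)) r)
            (+ₚ-cong (map-*-*ₚ a q r) (≈-trans (0∷-*ₚ (p *ₚ q) r) (∷-cong (*ₚ-assoc p q r))))

  *ₚ-identityˡ : ∀ q → (+ 1 ∷ []) *ₚ q ≈ q
  *ₚ-identityˡ q = coeffwise λ i → trans (coeff-∷-*ₚ (+ 1) [] q i) (unit i)
    where
    unit₀ : ∀ x → + 1 * x + + 0 ≡ x
    unit₀ = solve-∀
    unit : ∀ i → + 1 * coeff q i + coeff (+ 0 ∷ []) i ≡ coeff q i
    unit zero    = unit₀ (coeff q zero)
    unit (suc i) = unit₀ (coeff q (suc i))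

  ^ₚ-cong : ∀ {p p′} → p ≈ p′ → ∀ j → p ^ₚ j ≈ p′ ^ₚ j
  ^ₚ-cong p≈p′ zero = ≈-refl
  ^ₚ-cong {p} {p′} p≈p′ (suc j) = ≈-trans (*ₚ-congʳ (p ^ₚ j) p≈p′) (*ₚ-congˡ p′ (^ₚ-cong p≈p′ j))

  ^ₚ-distrib-*ₚ : ∀ p q j → (p *ₚ q) ^ₚ j ≈ (p ^ₚ j) *ₚ (q ^ₚ j)
  ^ₚ-distrib-*ₚ p q zero    = ≈-sym (*ₚ-identityˡ (+ 1 ∷ []))
  ^ₚ-distrib-*ₚ p q (suc j) = begin
    (p *ₚ q) *ₚ ((p *ₚ q) ^ₚ j)  ≈⟨ *ₚ-congˡ (p *ₚ q) (^ₚ-distrib-*ₚ p q j) ⟩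
    (p *ₚ q) *ₚ (pʲ *ₚ qʲ)       ≈⟨ *ₚ-assoc p q (pʲ *ₚ qʲ) ⟩
    p *ₚ (q *ₚ (pʲ *ₚ qʲ))       ≈⟨ *ₚ-congˡ p (*ₚ-assoc q pʲ qʲ) ⟨
    p *ₚ ((q *ₚ pʲ) *ₚ qʲ)       ≈⟨ *ₚ-congˡ p (*ₚ-congʳ qʲ (*ₚ-comm q pʲ)) ⟩
    p *ₚ ((pʲ *ₚ q) *ₚ qʲ)       ≈⟨ *ₚ-congˡ p (*ₚ-assoc pʲ q qʲ) ⟩
    p *ₚ (pʲ *ₚ (q *ₚ qʲ))       ≈⟨ *ₚ-assoc p pʲ (q *ₚ qʲ) ⟨
    (p *ₚ pʲ) *ₚ (q *ₚ qʲ)       ∎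
    where
    open ≈-Reasoning
    pʲ qʲ : Poly
    pʲ = p ^ₚ j
    qʲ = q ^ₚ j

  ^ₚ-2+ : ∀ p j → p ^ₚ suc (suc j) ≈ (p ^ₚ j) *ₚ (p *ₚ p)
  ^ₚ-2+ p j = ≈-trans (≈-sym (*ₚ-assoc p p (p ^ₚ j))) (*ₚ-comm (p *ₚ p) (p ^ₚ j))

  eval : ℤ → Poly → ℤ
  eval x []      = + 0
  eval x (c ∷ p) = c + x * eval x p

  eval-≈[] : ∀ x q → [] ≈ q → eval x q ≡ + 0
  eval-≈[] x []      _    = refl
  eval-≈[] x (b ∷ q) []≈q rewrite sym (coeff≡ []≈q zero) | eval-≈[] x q (coeffwise λ i → coeff≡ []≈q (suc i)) = vanish x
    where
    vanish : ∀ x → + 0 + x * + 0 ≡ + 0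
    vanish = solve-∀

  eval-cong : ∀ x {p q} → p ≈ q → eval x p ≡ eval x q
  eval-cong x {[]}    {q}     p≈q = sym (eval-≈[] x q p≈q)
  eval-cong x {c ∷ p} {[]}    p≈q = eval-≈[] x (c ∷ p) (≈-sym p≈q)
  eval-cong x {c ∷ p} {b ∷ q} p≈q =
    cong₂ (λ u v → u + x * v) (coeff≡ p≈q zero) (eval-cong x {p} {q} (coeffwise λ i → coeff≡ p≈q (suc i)))

  eval-+ₚ : ∀ x p q → eval x (p +ₚ q) ≡ eval x p + eval x q
  eval-+ₚ x []      q       = sym (+-identityˡ (eval x q))
  eval-+ₚ x (c ∷ p) []      = sym (+-identityʳ (c + x * eval x p))
  eval-+ₚ x (c ∷ p) (b ∷ q) rewrite eval-+ₚ x p q = regroup c b x (eval x p) (eval x q)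
    where
    regroup : ∀ c b x u v → c + b + x * (u + v) ≡ c + x * u + (b + x * v)
    regroup = solve-∀

  eval-map-* : ∀ x c p → eval x (map (c *_) p) ≡ c * eval x p
  eval-map-* x c []      = sym (*-zeroʳ c)
  eval-map-* x c (b ∷ p) rewrite eval-map-* x c p = factor x b c (eval x p)
    where
    factor : ∀ x b c u → c * b + x * (c * u) ≡ c * (b + x * u)
    factor = solve-∀

  eval-*ₚ : ∀ x p q → eval x (p *ₚ q) ≡ eval x p * eval x q
  eval-*ₚ x []      q = sym (*-zeroˡ (eval x q))
  eval-*ₚ x (c ∷ p) q rewrite eval-+ₚ x (map (c *_) q) (+ 0 ∷ (p *ₚ q)) | eval-map-* x c q | eval-*ₚ x p q =
    horner x c (eval x p) (eval x q)
    where
    horner : ∀ x c u v → c * v + (+ 0 + x * (u * v)) ≡ (c + x * u) * v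
    horner = solve-∀

  eval-^ₚ : ∀ x p j → eval x (p ^ₚ j) ≡ eval x p ^ j
  eval-^ₚ x p zero    = cong (λ z → + 1 + z) (*-zeroʳ x)
  eval-^ₚ x p (suc j) = trans (eval-*ₚ x p (p ^ₚ j)) (cong (eval x p *_) (eval-^ₚ x p j))

  eval-X- : ∀ a → eval a (X- a) ≡ + 0
  eval-X- a = root a
    where
    root : ∀ a → - a + a * (+ 1 + a * + 0) ≡ + 0
    root = solve-∀

  ^-≢0 : ∀ x j → x ≢ + 0 → x ^ j ≢ + 0
  ^-≢0 x zero    _   ()
  ^-≢0 x (suc j) x≢0 xʲ⁺¹≡0 with i*j≡0⇒i≡0∨j≡0 x xʲ⁺¹≡0
  ... | inj₁ x≡0  = x≢0 x≡0
  ... | inj₂ xʲ≡0 = ^-≢0 x j x≢0 xʲ≡0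

  *-≢0 : ∀ x y → x ≢ + 0 → y ≢ + 0 → x * y ≢ + 0
  *-≢0 x y x≢0 y≢0 xy≡0 with i*j≡0⇒i≡0∨j≡0 x xy≡0
  ... | inj₁ x≡0 = x≢0 x≡0
  ... | inj₂ y≡0 = y≢0 y≡0

  +-cancelʳ : ∀ x y z → x + z ≡ y + z → x ≡ y
  +-cancelʳ x y z eq = trans (undo x z) (trans (cong (_+ - z) eq) (sym (undo y z)))
    where
    undo : ∀ x z → x ≡ x + z + - z
    undo = solve-∀

  neg-*-cancelˡ : ∀ a .{{_ : NonZero a}} x y → - a * x ≡ - a * y → x ≡ y
  neg-*-cancelˡ a x y eq =
    *-cancelˡ-≡ a x y (neg-injective (trans (neg-distribˡ-* a x) (trans eq (sym (neg-distribˡ-* a y)))))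

  -- Comparing coefficients from the bottom up; this is where a ≠ 0 is used.
  X-*ₚ-cancelˡ : ∀ a .{{_ : NonZero a}} u v → (X- a) *ₚ u ≈ (X- a) *ₚ v → u ≈ v
  X-*ₚ-cancelˡ a u v eq = coeffwise go
    where
    lowest : ∀ w → coeff ((X- a) *ₚ w) zero ≡ - a * coeff w zero + + 0
    lowest w = coeff-∷-*ₚ (- a) (+ 1 ∷ []) w zero
    shifted : ∀ w i → coeff ((X- a) *ₚ w) (suc i) ≡ - a * coeff w (suc i) + coeff w i
    shifted w i = trans (coeff-∷-*ₚ (- a) (+ 1 ∷ []) w (suc i)) (cong (λ z → - a * coeff w (suc i) + z) (coeff≡ (*ₚ-identityˡ w) i))
    go : ∀ i → coeff u i ≡ coeff v i
    go zero    = neg-*-cancelˡ a _ _ (+-cancelʳ _ _ (+ 0) (trans (sym (lowest u)) (trans (coeff≡ eq zero) (lowest v))))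
    go (suc i) = neg-*-cancelˡ a _ _ (+-cancelʳ _ _ (coeff u i)
      (trans (sym (shifted u i)) (trans (coeff≡ eq (suc i)) (trans (shifted v i) (cong (λ z → - a * coeff v (suc i) + z) (sym (go i)))))))

  X-^ₚ-*ₚ-cancelˡ : ∀ a .{{_ : NonZero a}} j u v → ((X- a) ^ₚ j) *ₚ u ≈ ((X- a) ^ₚ j) *ₚ v → u ≈ v
  X-^ₚ-*ₚ-cancelˡ a zero    u v eq = ≈-trans (≈-sym (*ₚ-identityˡ u)) (≈-trans eq (*ₚ-identityˡ v))
  X-^ₚ-*ₚ-cancelˡ a (suc j) u v eq =
    X-^ₚ-*ₚ-cancelˡ a j u v
      (X-*ₚ-cancelˡ a _ _ (≈-trans (≈-sym (*ₚ-assoc (X- a) ((X- a) ^ₚ j) u)) (≈-trans eq (*ₚ-assoc (X- a) ((X- a) ^ₚ j) v))))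

  RootMult-intro : ∀ p a .{{_ : NonZero a}} m R → p ≈ ((X- a) ^ₚ m) *ₚ R → eval a R ≢ + 0 → RootMult p a m
  RootMult-intro p a m R p≈ Ra≢0 = (R , coeff≡ p≈) , not-divisible
    where
    not-divisible : ¬ (((X- a) ^ₚ suc m) ∣ₚ p)
    not-divisible (q , p≡) = Ra≢0 (begin
      eval a R                          ≡⟨ eval-cong a R≈ ⟩
      eval a ((X- a) *ₚ q)              ≡⟨ eval-*ₚ a (X- a) q ⟩
      eval a (X- a) * eval a q          ≡⟨ cong (_* eval a q) (eval-X- a) ⟩
      + 0 * eval a q                    ≡⟨ *-zeroˡ (eval a q) ⟩
      + 0                               ∎)
      where
      open ≡-Reasoning
      R≈ : R ≈ (X- a) *ₚ q
      R≈ = X-^ₚ-*ₚ-cancelˡ a m R ((X- a) *ₚ q)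
             (≈-trans (≈-sym p≈) (≈-trans (coeffwise p≡)
               (≈-trans (*ₚ-congʳ q (*ₚ-comm (X- a) ((X- a) ^ₚ m))) (*ₚ-assoc ((X- a) ^ₚ m) (X- a) q))))

module EvenExpansions where

  open import Data.Bool using (true; false; if_then_else_)
  open import Data.List using ([]; _∷_; map; upTo; applyUpTo)
  open import Data.List.Properties using (map-upTo)
  open import Data.Nat as ℕ using (ℕ; zero; suc; _∸_; _/_; _%_; _≡ᵇ_; _<ᵇ_; _≤?_; s≤s; ⌊_/2⌋)
  open import Data.Nat.Combinatorics using (_C_; nCk+nC[k+1]≡[n+1]C[k+1]; k>n⇒nCk≡0)
  open import Data.Nat.DivMod using (m*n%n≡0; m*n/n≡m; [m+kn]%n≡m%n)
  import Data.Nat.Properties as ℕ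
  open import Data.Integer as ℤ using (ℤ; +_; -[1+_]; _+_; _*_; -_; _^_)
  open import Data.Integer.Properties using (+-identityʳ; *-zeroʳ; pos-+)
  open import Data.Integer.Tactic.RingSolver using (solve-∀)
  open import Data.Sum using (inj₁; inj₂)
  open import Data.Product using (_,_)
  open import Data.Empty using (⊥-elim)
  open import Relation.Binary.PropositionalEquality
  open import Relation.Nullary using (yes; no)
  open import Defs using (SimpleGraph; matchingCount; μ; Poly; coeff; _+ₚ_; _*ₚ_; _^ₚ_)
  open Lists
  open Copies
  open Polynomials

  +-2+ : ∀ m n → m ℕ.+ suc (suc n) ≡ suc (suc (m ℕ.+ n))
  +-2+ m n = trans (ℕ.+-suc m (suc n)) (cong suc (ℕ.+-suc m n))

  −1^_ : ℕ → ℤ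
  −1^ k = (- + 1) ^ k

  -- p = Σ_{2k ≤ n} c(k) x^(n − 2k)
  record EvenExpansion (n : ℕ) (c : ℕ → ℤ) (p : Poly) : Set where
    field
      coeff-even  : ∀ e k → e ℕ.+ k ℕ.* 2 ≡ n → coeff p e ≡ c k
      coeff-odd   : ∀ e k → e ℕ.+ suc (k ℕ.* 2) ≡ n → coeff p e ≡ + 0
      coeff-above : ∀ e → n ℕ.< e → coeff p e ≡ + 0
  open EvenExpansion

  EvenExpansion-unique : ∀ {n c c′ p q} → EvenExpansion n c p → EvenExpansion n c′ q → (∀ k → c k ≡ c′ k) → p ≈ q
  EvenExpansion-unique {n} {p = p} {q} p-exp q-exp c≗c′ = coeffwise same
    where
    same : ∀ e → coeff p e ≡ coeff q e
    same e with e ≤? n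
    ... | no e≰n = trans (coeff-above p-exp e (ℕ.≰⇒> e≰n)) (sym (coeff-above q-exp e (ℕ.≰⇒> e≰n)))
    ... | yes e≤n with parity-view (n ∸ e)
    ...   | inj₁ (_ , r≡) = trans (coeff-even p-exp e k e+2k≡n) (trans (c≗c′ k) (sym (coeff-even q-exp e k e+2k≡n)))
      where
      k : ℕ
      k = ⌊ n ∸ e /2⌋
      e+2k≡n : e ℕ.+ k ℕ.* 2 ≡ n
      e+2k≡n = trans (cong (e ℕ.+_) (sym r≡)) (ℕ.m+[n∸m]≡n e≤n)
    ...   | inj₂ (_ , r≡) = trans (coeff-odd p-exp e k e+2k+1≡n) (sym (coeff-odd q-exp e k e+2k+1≡n))
      where
      k : ℕ
      k = ⌊ n ∸ e /2⌋
      e+2k+1≡n : e ℕ.+ suc (k ℕ.* 2) ≡ n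
      e+2k+1≡n = trans (cong (e ℕ.+_) (sym r≡)) (ℕ.m+[n∸m]≡n e≤n)

  EvenExpansion-≈ : ∀ {n c p q} → p ≈ q → EvenExpansion n c p → EvenExpansion n c q
  EvenExpansion-≈ p≈q p-exp = record
    { coeff-even  = λ e k eq → trans (sym (coeff≡ p≈q e)) (coeff-even p-exp e k eq)
    ; coeff-odd   = λ e k eq → trans (sym (coeff≡ p≈q e)) (coeff-odd p-exp e k eq)
    ; coeff-above = λ e n<e → trans (sym (coeff≡ p≈q e)) (coeff-above p-exp e n<e)
    }

  EvenExpansion-+ₚ : ∀ {n c c′ p q} → EvenExpansion n c p → EvenExpansion n c′ q → EvenExpansion n (λ k → c k + c′ k) (p +ₚ q)
  EvenExpansion-+ₚ {p = p} {q} p-exp q-exp = record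
    { coeff-even  = λ e k eq → trans (coeff-+ₚ p q e) (cong₂ _+_ (coeff-even p-exp e k eq) (coeff-even q-exp e k eq))
    ; coeff-odd   = λ e k eq → trans (coeff-+ₚ p q e) (cong₂ _+_ (coeff-odd p-exp e k eq) (coeff-odd q-exp e k eq))
    ; coeff-above = λ e n<e → trans (coeff-+ₚ p q e) (cong₂ _+_ (coeff-above p-exp e n<e) (coeff-above q-exp e n<e))
    }

  coeff-const-*ₚ : ∀ a p e → coeff ((a ∷ []) *ₚ p) e ≡ a * coeff p e
  coeff-const-*ₚ a p zero    = trans (coeff-∷-*ₚ a [] p zero) (+-identityʳ _)
  coeff-const-*ₚ a p (suc e) = trans (coeff-∷-*ₚ a [] p (suc e)) (+-identityʳ _)

  EvenExpansion-const-*ₚ : ∀ {n c p} a → EvenExpansion n c p → EvenExpansion n (λ k → a * c k) ((a ∷ []) *ₚ p)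
  EvenExpansion-const-*ₚ {p = p} a p-exp = record
    { coeff-even  = λ e k eq → trans (coeff-const-*ₚ a p e) (cong (a *_) (coeff-even p-exp e k eq))
    ; coeff-odd   = λ e k eq → trans (coeff-const-*ₚ a p e) (trans (cong (a *_) (coeff-odd p-exp e k eq)) (*-zeroʳ a))
    ; coeff-above = λ e n<e → trans (coeff-const-*ₚ a p e) (trans (cong (a *_) (coeff-above p-exp e n<e)) (*-zeroʳ a))
    }

  _X² : ℤ → Poly
  a X² = + 0 ∷ + 0 ∷ a ∷ []

  coeff-X²-*ₚ : ∀ a p e → coeff ((a X²) *ₚ p) (suc (suc e)) ≡ a * coeff p e
  coeff-X²-*ₚ a p e = trans (coeff≡ (0∷-*ₚ (+ 0 ∷ a ∷ []) p) (suc (suc e)))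
                            (trans (coeff≡ (0∷-*ₚ (a ∷ []) p) (suc e)) (coeff-const-*ₚ a p e))

  coeff-X²-*ₚ-low : ∀ a p e → e ℕ.< 2 → coeff ((a X²) *ₚ p) e ≡ + 0
  coeff-X²-*ₚ-low a p zero          _ = coeff≡ (0∷-*ₚ (+ 0 ∷ a ∷ []) p) zero
  coeff-X²-*ₚ-low a p (suc zero)    _ = trans (coeff≡ (0∷-*ₚ (+ 0 ∷ a ∷ []) p) (suc zero)) (coeff≡ (0∷-*ₚ (a ∷ []) p) zero)
  coeff-X²-*ₚ-low a p (suc (suc e)) (s≤s (s≤s ()))

  -- c must vanish beyond the degree, since the coefficients of x⁰ and x¹ in a x² p are 0.
  EvenExpansion-X²-*ₚ : ∀ {n c p} a → (∀ k → n ℕ.< k ℕ.* 2 → c k ≡ + 0) →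
    EvenExpansion n c p → EvenExpansion (suc (suc n)) (λ k → a * c k) ((a X²) *ₚ p)
  EvenExpansion-X²-*ₚ {n} {c} {p} a c-top p-exp = record { coeff-even = at-even ; coeff-odd = at-odd ; coeff-above = at-above }
    where
    at-even : ∀ e k → e ℕ.+ k ℕ.* 2 ≡ suc (suc n) → coeff ((a X²) *ₚ p) e ≡ a * c k
    at-even zero          k eq = trans (coeff-X²-*ₚ-low a p zero (s≤s ℕ.z≤n))
                                       (sym (trans (cong (a *_) (c-top k (subst (n ℕ.<_) (sym eq) (ℕ.m<n⇒m<1+n (ℕ.n<1+n n))))) (*-zeroʳ a)))
    at-even (suc zero)    k eq = trans (coeff-X²-*ₚ-low a p (suc zero) (s≤s (s≤s ℕ.z≤n)))
                                       (sym (trans (cong (a *_) (c-top k (subst (n ℕ.<_) (sym (ℕ.suc-injective eq)) (ℕ.n<1+n n)))) (*-zeroʳ a)))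
    at-even (suc (suc e)) k eq = trans (coeff-X²-*ₚ a p e) (cong (a *_) (coeff-even p-exp e k (ℕ.suc-injective (ℕ.suc-injective eq))))
    at-odd : ∀ e k → e ℕ.+ suc (k ℕ.* 2) ≡ suc (suc n) → coeff ((a X²) *ₚ p) e ≡ + 0
    at-odd zero          k eq = coeff-X²-*ₚ-low a p zero (s≤s ℕ.z≤n)
    at-odd (suc zero)    k eq = coeff-X²-*ₚ-low a p (suc zero) (s≤s (s≤s ℕ.z≤n))
    at-odd (suc (suc e)) k eq =
      trans (coeff-X²-*ₚ a p e) (trans (cong (a *_) (coeff-odd p-exp e k (ℕ.suc-injective (ℕ.suc-injective eq)))) (*-zeroʳ a))
    at-above : ∀ e → suc (suc n) ℕ.< e → coeff ((a X²) *ₚ p) e ≡ + 0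
    at-above (suc (suc e)) (s≤s (s≤s n<e)) = trans (coeff-X²-*ₚ a p e) (trans (cong (a *_) (coeff-above p-exp e n<e)) (*-zeroʳ a))

  shift : (ℕ → ℤ) → ℕ → ℤ
  shift c zero    = + 0
  shift c (suc k) = c k

  EvenExpansion-raise : ∀ {n c p} → EvenExpansion n c p → EvenExpansion (suc (suc n)) (shift c) p
  EvenExpansion-raise {n} {c} {p} p-exp = record { coeff-even = at-even ; coeff-odd = at-odd ; coeff-above = at-above }
    where
    at-even : ∀ e k → e ℕ.+ k ℕ.* 2 ≡ suc (suc n) → coeff p e ≡ shift c k
    at-even e zero    eq = coeff-above p-exp e (subst (n ℕ.<_) (sym (trans (sym (ℕ.+-identityʳ e)) eq)) (ℕ.m<n⇒m<1+n (ℕ.n<1+n n)))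
    at-even e (suc k) eq = coeff-even p-exp e k (ℕ.suc-injective (ℕ.suc-injective (trans (sym (+-2+ e (k ℕ.* 2))) eq)))
    at-odd : ∀ e k → e ℕ.+ suc (k ℕ.* 2) ≡ suc (suc n) → coeff p e ≡ + 0
    at-odd e zero    eq = coeff-above p-exp e (subst (n ℕ.<_) (ℕ.suc-injective (sym (trans (ℕ.+-comm 1 e) eq))) (ℕ.n<1+n n))
    at-odd e (suc k) eq = coeff-odd p-exp e k (ℕ.suc-injective (ℕ.suc-injective (trans (sym (+-2+ e (suc (k ℕ.* 2)))) eq)))
    at-above : ∀ e → suc (suc n) ℕ.< e → coeff p e ≡ + 0
    at-above e n+2<e = coeff-above p-exp e (ℕ.<-trans (ℕ.n<1+n n) (ℕ.<-trans (ℕ.n<1+n (suc n)) n+2<e))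

  EvenExpansion-cong : ∀ {n c c′ p} → (∀ k → c k ≡ c′ k) → EvenExpansion n c p → EvenExpansion n c′ p
  EvenExpansion-cong c≗c′ p-exp = record
    { coeff-even  = λ e k eq → trans (coeff-even p-exp e k eq) (c≗c′ k)
    ; coeff-odd   = coeff-odd p-exp
    ; coeff-above = coeff-above p-exp
    }

  X²-1 : Poly
  X²-1 = -[1+ 0 ] ∷ + 0 ∷ + 1 ∷ []

  binomialSigns : ℕ → ℕ → ℤ
  binomialSigns j k = −1^ k * + (j C k)

  binomialSigns-vanishes : ∀ j k → j ℕ.* 2 ℕ.< k ℕ.* 2 → binomialSigns j k ≡ + 0
  binomialSigns-vanishes j k 2j<2k rewrite k>n⇒nCk≡0 (ℕ.*-cancelʳ-< 2 j k 2j<2k) = *-zeroʳ (−1^ k)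

  X²-1^-expansion : ∀ j → EvenExpansion (j ℕ.* 2) (binomialSigns j) (X²-1 ^ₚ j)
  X²-1^-expansion zero = record { coeff-even = at-even ; coeff-odd = at-odd ; coeff-above = at-above }
    where
    at-even : ∀ e k → e ℕ.+ k ℕ.* 2 ≡ 0 → coeff (+ 1 ∷ []) e ≡ binomialSigns 0 k
    at-even zero zero refl = refl
    at-odd : ∀ e k → e ℕ.+ suc (k ℕ.* 2) ≡ 0 → coeff (+ 1 ∷ []) e ≡ + 0
    at-odd zero    k ()
    at-odd (suc e) k ()
    at-above : ∀ e → 0 ℕ.< e → coeff (+ 1 ∷ []) e ≡ + 0
    at-above (suc e) _ = refl
  X²-1^-expansion (suc j) =
    EvenExpansion-≈ (≈-sym (*ₚ-distribʳ (-[1+ 0 ] ∷ []) ((+ 1) X²) (X²-1 ^ₚ j)))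
      (EvenExpansion-cong pascal
        (EvenExpansion-+ₚ (EvenExpansion-raise (EvenExpansion-const-*ₚ -[1+ 0 ] (X²-1^-expansion j)))
                          (EvenExpansion-X²-*ₚ (+ 1) (binomialSigns-vanishes j) (X²-1^-expansion j))))
    where
    pascal : ∀ k → shift (λ k → -[1+ 0 ] * binomialSigns j k) k + + 1 * binomialSigns j k ≡ binomialSigns (suc j) k
    pascal zero    = refl
    pascal (suc k) = begin
      -[1+ 0 ] * (−1^ k * + (j C k)) + + 1 * (- + 1 * −1^ k * + (j C suc k))
        ≡⟨ regroup (−1^ k) (+ (j C k)) (+ (j C suc k)) ⟩
      - + 1 * −1^ k * (+ (j C k) + + (j C suc k))
        ≡⟨ cong (λ z → - + 1 * −1^ k * z) (sym (pos-+ (j C k) (j C suc k))) ⟩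
      - + 1 * −1^ k * + (j C k ℕ.+ j C suc k)
        ≡⟨ cong (λ z → - + 1 * −1^ k * + z) (nCk+nC[k+1]≡[n+1]C[k+1] j k) ⟩
      - + 1 * −1^ k * + (suc j C suc k) ∎
      where
      open ≡-Reasoning
      regroup : ∀ s a b → -[1+ 0 ] * (s * a) + + 1 * (- + 1 * s * b) ≡ - + 1 * s * (a + b)
      regroup = solve-∀

  coeff-map-upTo : ∀ M (f : ℕ → ℤ) e → coeff (map f (upTo M)) e ≡ (if e <ᵇ M then f e else + 0)
  coeff-map-upTo M f e = trans (cong (λ p → coeff p e) (map-upTo f M)) (coeff-applyUpTo M f e)
    where
    coeff-applyUpTo : ∀ M (f : ℕ → ℤ) e → coeff (applyUpTo f M) e ≡ (if e <ᵇ M then f e else + 0)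
    coeff-applyUpTo zero    f e       = refl
    coeff-applyUpTo (suc M) f zero    = refl
    coeff-applyUpTo (suc M) f (suc e) = coeff-applyUpTo M (λ x → f (suc x)) e

  μ-expansion : ∀ {n} (G : SimpleGraph n) → EvenExpansion n (λ k → −1^ k * + matchingCount G k) (μ G)
  μ-expansion {n} G = record { coeff-even = at-even ; coeff-odd = at-odd ; coeff-above = at-above }
    where
    term : ℕ → ℤ
    term r = −1^ r * + matchingCount G r
    F : ℕ → ℤ
    F r = if (r % 2) ≡ᵇ 0 then term (r / 2) else + 0
    coeff-μ : ∀ e → coeff (μ G) e ≡ (if e <ᵇ suc n then F (n ∸ e) else + 0)
    coeff-μ e = coeff-map-upTo (suc n) _ e
    below : ∀ e r → e ℕ.+ r ≡ n → coeff (μ G) e ≡ F r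
    below e r eq = begin
      coeff (μ G) e                               ≡⟨ coeff-μ e ⟩
      (if e <ᵇ suc n then F (n ∸ e) else + 0)     ≡⟨ cong (λ b → if b then F (n ∸ e) else + 0) e≤n ⟩
      F (n ∸ e)                                   ≡⟨ cong F (trans (cong (_∸ e) (sym eq)) (ℕ.m+n∸m≡n e r)) ⟩
      F r                                         ∎
      where
      open ≡-Reasoning
      e≤n : (e <ᵇ suc n) ≡ true
      e≤n = <⇒<ᵇ-true {e} {suc n} (s≤s (subst (e ℕ.≤_) eq (ℕ.m≤m+n e r)))
    at-even : ∀ e k → e ℕ.+ k ℕ.* 2 ≡ n → coeff (μ G) e ≡ term k
    at-even e k eq = trans (below e (k ℕ.* 2) eq)
                           (trans (cong (λ r → if r ≡ᵇ 0 then term (k ℕ.* 2 / 2) else + 0) (m*n%n≡0 k 2)) (cong term (m*n/n≡m k 2)))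
    at-odd : ∀ e k → e ℕ.+ suc (k ℕ.* 2) ≡ n → coeff (μ G) e ≡ + 0
    at-odd e k eq = trans (below e (suc (k ℕ.* 2)) eq)
                          (cong (λ r → if r ≡ᵇ 0 then term (suc (k ℕ.* 2) / 2) else + 0) ([m+kn]%n≡m%n 1 k 2))
    at-above : ∀ e → n ℕ.< e → coeff (μ G) e ≡ + 0
    at-above e n<e rewrite coeff-μ e with e <ᵇ suc n in e≤n
    ... | true  = ⊥-elim (ℕ.<⇒≱ n<e (ℕ.≤-pred (<ᵇ-true⇒< e≤n)))
    ... | false = refl

module Factorisation where

  open import Data.Nat as ℕ using (ℕ; zero; suc; s≤s)
  open import Data.Nat.Combinatorics using (_C_)
  open import Data.Integer as ℤ using (+_; -[1+_]; _+_; _*_; -_; _^_)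
  open import Data.Integer.Properties using (pos-+; pos-*; *-identityˡ)
  open import Data.Integer.Tactic.RingSolver using (solve-∀)
  open import Relation.Binary.PropositionalEquality
  open import Defs using (SimpleGraph; matchingCount; μ; Poly; _+ₚ_; _*ₚ_; _^ₚ_; X-_; RootMult)
  open Polynomials
  open EvenExpansions

  cofactor : ℕ → Poly
  cofactor d = (X²-1 *ₚ X²-1) +ₚ ((- + d) X²)

  X²-1≈[X-1][X+1] : X²-1 ≈ (X- (+ 1)) *ₚ (X- -[1+ 0 ])
  X²-1≈[X-1][X+1] = coeffwise λ { 0 → refl ; 1 → refl ; 2 → refl ; (suc (suc (suc _))) → refl }

  module _ (m₂ d : ℕ) (G : SimpleGraph (suc (suc m₂) ℕ.* 2))
           (p₀ : matchingCount G 0 ≡ 1)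
           (p₁₊ : ∀ k → matchingCount G (suc k) ≡ suc (suc m₂) C suc k ℕ.+ d ℕ.* (m₂ C k)) where

    μ≈powers : μ G ≈ (X²-1 ^ₚ suc (suc m₂)) +ₚ (((- + d) X²) *ₚ (X²-1 ^ₚ m₂))
    μ≈powers = EvenExpansion-unique (μ-expansion G)
      (EvenExpansion-+ₚ (X²-1^-expansion (suc (suc m₂)))
                        (EvenExpansion-raise (EvenExpansion-X²-*ₚ (- + d) (binomialSigns-vanishes m₂) (X²-1^-expansion m₂))))
      coefficients
      where
      coefficients : ∀ k → −1^ k * + matchingCount G k
                           ≡ binomialSigns (suc (suc m₂)) k + shift (λ k → - + d * binomialSigns m₂ k) k
      coefficients zero    rewrite p₀ = refl
      coefficients (suc k) = begin
        −1^ suc k * + matchingCount G (suc k)  ≡⟨ cong (λ p → −1^ suc k * + p) (p₁₊ k) ⟩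
        −1^ suc k * + (A ℕ.+ d ℕ.* B)          ≡⟨ cong (−1^ suc k *_) (trans (pos-+ A (d ℕ.* B)) (cong (λ z → + A + z) (pos-* d B))) ⟩
        −1^ suc k * (+ A + + d * + B)          ≡⟨ distribute (−1^ k) (+ A) (+ d) (+ B) ⟩
        −1^ suc k * + A + - + d * (−1^ k * + B) ∎
        where
        open ≡-Reasoning
        A B : ℕ
        A = suc (suc m₂) C suc k
        B = m₂ C k
        distribute : ∀ s a x b → - + 1 * s * (a + x * b) ≡ - + 1 * s * a + - x * (s * b)
        distribute = solve-∀

    μ≈factored : μ G ≈ (X²-1 ^ₚ m₂) *ₚ cofactor d
    μ≈factored = begin
      μ G
        ≈⟨ μ≈powers ⟩
      (X²-1 ^ₚ suc (suc m₂)) +ₚ (((- + d) X²) *ₚ (X²-1 ^ₚ m₂))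
        ≈⟨ +ₚ-cong (^ₚ-2+ X²-1 m₂) (*ₚ-comm ((- + d) X²) (X²-1 ^ₚ m₂)) ⟩
      ((X²-1 ^ₚ m₂) *ₚ (X²-1 *ₚ X²-1)) +ₚ ((X²-1 ^ₚ m₂) *ₚ ((- + d) X²))
        ≈⟨ *ₚ-distribˡ (X²-1 ^ₚ m₂) (X²-1 *ₚ X²-1) ((- + d) X²) ⟨
      (X²-1 ^ₚ m₂) *ₚ cofactor d ∎
      where open ≈-Reasoning

    eval-cofactor : ∀ a → a * a ≡ + 1 → eval a X²-1 ≡ + 0 → eval a (cofactor d) ≡ - + d
    eval-cofactor a a²≡1 root = begin
      eval a (cofactor d)                                   ≡⟨ eval-+ₚ a (X²-1 *ₚ X²-1) ((- + d) X²) ⟩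
      eval a (X²-1 *ₚ X²-1) + eval a ((- + d) X²)           ≡⟨ cong (_+ eval a ((- + d) X²)) (trans (eval-*ₚ a X²-1 X²-1) (cong₂ _*_ root root)) ⟩
      + 0 * + 0 + eval a ((- + d) X²)                       ≡⟨ evaluate a (+ d) ⟩
      (a * a) * - + d                                       ≡⟨ cong (_* - + d) a²≡1 ⟩
      + 1 * - + d                                           ≡⟨ *-identityˡ (- + d) ⟩
      - + d                                                 ∎
      where
      open ≡-Reasoning
      evaluate : ∀ a x → + 0 * + 0 + (+ 0 + a * (+ 0 + a * (- x + a * + 0))) ≡ (a * a) * - x
      evaluate = solve-∀

    rootMult-μ : ∀ a b .{{_ : ℤ.NonZero a}} → X²-1 ≈ (X- a) *ₚ (X- b) → a * a ≡ + 1 → eval a X²-1 ≡ + 0 →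
                 eval a (X- b) ≢ + 0 → 0 ℕ.< d → RootMult (μ G) a m₂
    rootMult-μ a b X²-1≈ a²≡1 root b-not-root 0<d = RootMult-intro (μ G) a m₂ R μ≈X-a^m₂*R eval-R≢0
      where
      R : Poly
      R = ((X- b) ^ₚ m₂) *ₚ cofactor d
      μ≈X-a^m₂*R : μ G ≈ ((X- a) ^ₚ m₂) *ₚ R
      μ≈X-a^m₂*R = ≈-trans μ≈factored
        (≈-trans (*ₚ-congʳ (cofactor d) (≈-trans (^ₚ-cong X²-1≈ m₂) (^ₚ-distrib-*ₚ (X- a) (X- b) m₂)))
                 (*ₚ-assoc ((X- a) ^ₚ m₂) ((X- b) ^ₚ m₂) (cofactor d)))
      eval-R≢0 : eval a R ≢ + 0
      eval-R≢0 eq = *-≢0 (eval a (X- b) ^ m₂) (- + d) (^-≢0 (eval a (X- b)) m₂ b-not-root) (-d≢0 0<d)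
        (trans (sym (cong₂ _*_ (eval-^ₚ a (X- b) m₂) (eval-cofactor a a²≡1 root))) (trans (sym (eval-*ₚ a ((X- b) ^ₚ m₂) (cofactor d))) eq))
        where
        -d≢0 : ∀ {d} → 0 ℕ.< d → - + d ≢ + 0
        -d≢0 (s≤s _) ()

open import Data.Bool using (Bool; true; false)
open import Data.Empty using (⊥-elim)
open import Data.Fin using (Fin; toℕ; fromℕ<)
open import Data.Fin.Properties using (toℕ<n; fromℕ<-toℕ; toℕ-fromℕ<)
open import Data.Integer using (+_; -[1+_])
open import Data.Nat as ℕ using (ℕ; zero; suc; _≤_; _<_; _∸_; _/_; z≤n; s≤s; ⌊_/2⌋)
open import Data.Nat.Combinatorics using (_C_)
open import Data.Nat.DivMod using (m*n/n≡m)
open import Data.Nat.Divisibility using (_∣_; divides)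
open import Data.List using (length)
open import Data.Product using (_×_; _,_; proj₁; proj₂)
open import Relation.Binary.PropositionalEquality
open import Relation.Nullary using (yes; no)
open import Defs
open Lists
open Copies
open Matchings
open FinEdges
open HubGraphs
open Polynomials
open Factorisation

module Member (m₂ : ℕ) (G : SimpleGraph (suc (suc m₂) ℕ.* 2)) (w : Fin (suc (suc m₂) ℕ.* 2))
              (S : Fin (suc (suc m₂) ℕ.* 2) → Bool) (adm : Admissible (suc (suc m₂) ℕ.* 2) w S)
              (adj≗ : ∀ u v → adj G u v ≡ FAdj w S u v) where

  n : ℕ
  n = suc (suc m₂) ℕ.* 2

  Sℕ : ℕ → Bool
  Sℕ x with x ℕ.<? n
  ... | yes x<n = S (fromℕ< x<n)
  ... | no _    = false

  Sℕ-toℕ : ∀ v → Sℕ (toℕ v) ≡ S v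
  Sℕ-toℕ v with toℕ v ℕ.<? n
  ... | yes v<n = cong S (fromℕ<-toℕ v v<n)
  ... | no v≮n  = ⊥-elim (v≮n (toℕ<n v))

  Sℕ-off-hub-copy : ∀ x → Sℕ x ≡ true → ⌊ x /2⌋ ≢ ⌊ toℕ w /2⌋
  Sℕ-off-hub-copy x Sx same with x ℕ.<? n
  ... | yes x<n = proj₁ adm (fromℕ< x<n) Sx
                    (trans (cong (_/ 2) (toℕ-fromℕ< x<n)) (trans (sym (⌊n/2⌋≡n/2 x)) (trans same (⌊n/2⌋≡n/2 (toℕ w)))))

  open HubGraph m₂ (toℕ w) Sℕ Sℕ-off-hub-copy (toℕ<n w)

  adj≗adjℕ : ∀ u v → adj G u v ≡ adjℕ (toℕ u) (toℕ v)
  adj≗adjℕ u v rewrite adj≗ u v | Sℕ-toℕ u | Sℕ-toℕ v | ⌊n/2⌋≡n/2 (toℕ u) | ⌊n/2⌋≡n/2 (toℕ v) = refl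

  matchingCount≡edgesℕ : ∀ k → matchingCount G k ≡ matchingCountℕ edgesℕ k
  matchingCount≡edgesℕ k = trans (matchingCount-toℕ G k) (cong (λ E → matchingCountℕ E k) (edges-toℕ G adjℕ adj≗adjℕ))

  -- Admissibility gives a neighbour of w in a copy other than its own: copy 1 if w is in copy 0, else copy 0.
  w-has-spoke : 0 < length spokes
  w-has-spoke with proj₂ adm (other (toℕ w / 2)) (subst (other (toℕ w / 2) <_) (sym (m*n/n≡m (suc (suc m₂)) 2)) (other< _))
                                  (other≢ (toℕ w / 2))
    where
    other : ℕ → ℕ
    other zero    = 1
    other (suc _) = 0
    other< : ∀ c → other c < suc (suc m₂)
    other< zero    = s≤s (s≤s z≤n)
    other< (suc _) = s≤s z≤n
    other≢ : ∀ c → other c ≢ c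
    other≢ zero    ()
    other≢ (suc _) ()
  ... | v , _ , Sv = spokes-nonempty (toℕ v) (toℕ<n v) (trans (Sℕ-toℕ v) Sv)

  matchingCount-zero′ : matchingCount G 0 ≡ 1
  matchingCount-zero′ = trans (matchingCount≡edgesℕ 0) matchingCount-edgesℕ-zero

  matchingCount-suc : ∀ k → matchingCount G (suc k) ≡ suc (suc m₂) C suc k ℕ.+ length spokes ℕ.* (m₂ C k)
  matchingCount-suc k = trans (matchingCount≡edgesℕ (suc k)) (matchingCount-edgesℕ-suc k)

  root-multiplicities : RootMult (μ G) (+ 1) m₂ × RootMult (μ G) -[1+ 0 ] m₂
  root-multiplicities =
      rootMult-μ m₂ (length spokes) G matchingCount-zero′ matchingCount-suc (+ 1) -[1+ 0 ]
        X²-1≈[X-1][X+1] refl refl (λ ()) w-has-spoke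
    , rootMult-μ m₂ (length spokes) G matchingCount-zero′ matchingCount-suc -[1+ 0 ] (+ 1)
        (≈-trans X²-1≈[X-1][X+1] (*ₚ-comm (X- (+ 1)) (X- -[1+ 0 ]))) refl refl (λ ()) w-has-spoke

lemma3p3 : (n : ℕ) → 2 ∣ n → 8 ≤ n → (G : SimpleGraph n) → InF n G →
  RootMult (μ G) (+ 1) ((n ∸ 4) / 2) × RootMult (μ G) -[1+ 0 ] ((n ∸ 4) / 2)
lemma3p3 n (divides (suc (suc m₂)) refl) _ G (w , S , adm , adj≗) =
  subst (λ j → RootMult (μ G) (+ 1) j × RootMult (μ G) -[1+ 0 ] j) (sym (m*n/n≡m m₂ 2))
        (Member.root-multiplicities m₂ G w S adm adj≗)
lemma3p3 n (divides zero    refl) () _ _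
lemma3p3 n (divides (suc zero) refl) (s≤s (s≤s ())) _ _
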